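{- Let $q_1$ and $q_2$ be odd prime powers and let $\alpha_1,\alpha_2$ be primitive elements of $\operatorname{GF}(q_1)$ and $\operatorname{GF}(q_2)$, respectively. Then $\Gamma_2(\alpha_1,\alpha_2)$ is a Neumaier graph if and only if $q_1=q_2$.
   Context: With $m=2$: let $\mathsf C_1(\alpha_1) = \{(\alpha_1^k,0): 0\le k\le q_1-2\}$ and $\mathsf D_0(\alpha_1,\alpha_2) = \{(\alpha_1^{i_1},\alpha_2^{i_2}) : i_1\equiv i_2 \pmod 2\}$ in the additive group $\operatorname{GF}(q_1)\times\operatorname{GF}(q_2)$; $\Gamma_2(\alpha_1,\alpha_2)$ is the Cayley (di)graph on this group with connection set $\mathsf C_1(\alpha_1)\cup\mathsf D_0(\alpha_1,\alpha_2)$ (arcs $(g,s+g)$). A Neumaier graph is a non-complete undirected edge-regular graph (regular, every edge in a constant number of triangles) having a clique $C$ such that every vertex outside $C$ is adjacent to exactly $e>0$ vertices of $C$. -}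

module Defs where

open import Data.Nat as ℕ using (ℕ; zero; suc; _∸_; _≡ᵇ_)
open import Data.Nat.Primality using (Prime)
open import Data.Nat.Divisibility using (_∣_)
open import Data.Nat.Properties using (_≟_)
open import Data.Fin as F using (Fin)
open import Data.Fin.Properties as FP using ()
open import Data.Bool using (Bool; true; false; T; _∧_)
open import Data.List using (List; filter; length; allFin; cartesianProduct; map)
open import Data.Product using (Σ; ∃; ∃-syntax; _×_; _,_; proj₁; proj₂)
open import Data.Sum using (_⊎_)
open import Relation.Nullary using (¬_; Dec)
open import Relation.Nullary.Decidable using (_×-dec_; _⊎-dec_)
open import Relation.Nullary.Decidable using (⌊_⌋)
open import Relation.Binary.PropositionalEquality using (_≡_; _≢_)
open import Algebra.Structures using (IsCommutativeRing)

IsPrimePower : ℕ → Set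
IsPrimePower q = ∃[ p ] ∃[ k ] (Prime p × 1 ℕ.≤ k × q ≡ p ℕ.^ k)

Odd : ℕ → Set
Odd q = ¬ (2 ∣ q)

-- A finite field of order q, with carrier Fin q and propositional equality.
-- (GF(q) is unique up to isomorphism, so quantifying over all such
-- structures is the same as speaking of "the" field GF(q).)

record FiniteField (q : ℕ) : Set where
  field
    _+_ _*_ : Fin q → Fin q → Fin q
    -_      : Fin q → Fin q
    0# 1#   : Fin q
    isCommutativeRing : IsCommutativeRing _≡_ _+_ _*_ -_ 0# 1#
    0≢1     : 0# ≢ 1#
    inverse : ∀ x → x ≢ 0# → ∃[ y ] (x * y ≡ 1#)

  infixl 6 _+_
  infixl 7 _*_

  _-_ : Fin q → Fin q → Fin q
  x - y = x + (- y)

  _^_ : Fin q → ℕ → Fin q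
  x ^ zero  = 1#
  x ^ suc n = x * (x ^ n)

  IsPrimitive : Fin q → Set
  IsPrimitive α = α ≢ 0# × (∀ x → x ≢ 0# → ∃[ k ] (x ≡ α ^ k))

module Graph {n : ℕ} (Adj : Fin n → Fin n → Set)
             (adj? : ∀ u v → Dec (Adj u v)) where

  count : (Fin n → Bool) → ℕ
  count P = length (filter (λ w → Data.Bool._≟_ (P w) true) (allFin n))
    where import Data.Bool

  adjᵇ : Fin n → Fin n → Bool
  adjᵇ u v = ⌊ adj? u v ⌋

  degree : Fin n → ℕ
  degree u = count (λ w → adjᵇ u w)

  commonNeighbours : Fin n → Fin n → ℕ
  commonNeighbours u v = count (λ w → adjᵇ u w ∧ adjᵇ v w)

  IsUndirected : Set
  IsUndirected = (∀ u v → Adj u v → Adj v u) × (∀ u → ¬ Adj u u)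

  IsNonComplete : Set
  IsNonComplete = ∃[ u ] ∃[ v ] (u ≢ v × ¬ Adj u v)

  IsRegular : Set
  IsRegular = ∃[ k ] (∀ u → degree u ≡ k)

  IsEdgeRegular : Set
  IsEdgeRegular = IsRegular × ∃[ λ' ] (∀ u v → Adj u v → commonNeighbours u v ≡ λ')

  IsClique : (Fin n → Bool) → Set
  IsClique C = ∀ u v → T (C u) → T (C v) → u ≢ v → Adj u v

  IsRegularClique : (Fin n → Bool) → ℕ → Set
  IsRegularClique C e =
    IsClique C × (∀ v → ¬ T (C v) → count (λ w → C w ∧ adjᵇ v w) ≡ e)

  IsNeumaier : Set
  IsNeumaier = IsUndirected × IsNonComplete × IsEdgeRegular ×
               ∃[ C ] ∃[ e ] (1 ℕ.≤ e × IsRegularClique C e)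

-- The Cayley digraph Γ₂(α₁,α₂) on GF(q₁) × GF(q₂), with vertex set
-- encoded as Fin (q₁ * q₂) via Data.Fin's combine/remQuot.

module Gamma2 {q₁ q₂ : ℕ} (F₁ : FiniteField q₁) (F₂ : FiniteField q₂)
              (α₁ : Fin q₁) (α₂ : Fin q₂) where
  private
    module F₁ = FiniteField F₁
    module F₂ = FiniteField F₂

  InC1 : Fin q₁ × Fin q₂ → Set
  InC1 (x , y) = ∃[ k ] (x ≡ α₁ F₁.^ F.toℕ {q₁ ∸ 1} k × y ≡ F₂.0#)

  InD0 : Fin q₁ × Fin q₂ → Set
  InD0 (x , y) = ∃[ i₁ ] ∃[ i₂ ]
    ((F.toℕ {q₁ ∸ 1} i₁ ℕ.% 2 ≡ F.toℕ {q₂ ∸ 1} i₂ ℕ.% 2) ×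
     x ≡ α₁ F₁.^ F.toℕ i₁ × y ≡ α₂ F₂.^ F.toℕ i₂)

  InS : Fin q₁ × Fin q₂ → Set
  InS s = InC1 s ⊎ InD0 s

  V : Set
  V = Fin (q₁ ℕ.* q₂)

  pair : V → Fin q₁ × Fin q₂
  pair = F.remQuot q₂

  Arc : V → V → Set
  Arc g h = InS (proj₁ (pair h) F₁.- proj₁ (pair g) , proj₂ (pair h) F₂.- proj₂ (pair g))

  InS? : ∀ s → Dec (InS s)
  InS? (x , y) =
    FP.any? (λ k → (x FP.≟ _) ×-dec (y FP.≟ F₂.0#))
    ⊎-dec FP.any? (λ i₁ → FP.any? (λ i₂ →
            ((F.toℕ i₁ ℕ.% 2) ≟ (F.toℕ i₂ ℕ.% 2)) ×-dec
            ((x FP.≟ _) ×-dec (y FP.≟ _))))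

  Arc? : ∀ g h → Dec (Arc g h)
  Arc? g h = InS? _

  open Graph Arc Arc? public

{-# OPTIONS --safe #-}
module Submission where

-- Write qᵢ = 2hᵢ + 1 and let χᵢ be the quadratic character of GF(qᵢ), computed as the parity of
-- the discrete logarithm to base αᵢ. Then (x , y) lies in the connection set iff x ≠ 0 and either
-- y = 0 or χ₁ x = χ₂ y. By translation invariance, the number of common neighbours of the ends of
-- an arc with difference (a , b) is Σ_{e,d} Nₐ(e , d) W(e , d), where Nₐ are the cyclotomic numbers
-- of order 2 of a in GF(q₁) and W counts the admissible second coordinates. The row, column and
-- diagonal sums of Nₐ are known and determine Nₐ. Hence an arc with b = 0 lies in
-- λ = 2h₁ - 1 + (h₁ - 1)h₂ triangles, and, when χ₁(-1) = χ₂(-1), an arc with b ≠ 0 lies in λ′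
-- triangles where 2λ′ + h₁ = 2λ + h₂. Undirectedness forces χ₁(-1) = χ₂(-1), so edge-regularity
-- forces h₁ = h₂; conversely, for h₁ = h₂ the graph is edge-regular, and GF(q₁) × {0} is a clique
-- every outside vertex of which is adjacent to h₁ of its vertices.

open import Defs
open import Data.Nat using (ℕ)
open import Data.Fin using (Fin)
open import Data.Product using (_×_)
open import Relation.Binary.PropositionalEquality using (_≡_)
open import Function.Bundles using (_⇔_)

open import Data.Nat as ℕ using (zero; suc; _∸_; _%_; _/_; _<_; parity; NonZero; >-nonZero)
import Data.Nat.Properties as NP
open import Data.Nat.DivMod using (m≡m%n+[m/n]*n; m%n<n)
open import Data.Nat.Divisibility using (∣m∣n⇒∣m+n; n∣n; divides)
open import Data.Nat.Tactic.RingSolver using (solve-∀)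
open import Data.Bool as Bool using (Bool; true; false; T; _∧_)
open import Data.Unit using (tt)
open import Data.Fin as F using (zero; suc; toℕ; fromℕ<; combine; _↑ˡ_; _↑ʳ_)
import Data.Fin.Properties as FP
open import Data.Fin.Permutation as Perm using (Permutation; permutation)
open import Data.Parity as ℙ using (Parity; 0ℙ; 1ℙ)
import Data.Parity.Properties as ℙP
open import Data.List using (filter; length; tabulate)
open import Data.Product using (∃-syntax; _,_; proj₁; proj₂)
open import Data.Sum using (inj₁; inj₂)
open import Data.Empty using (⊥-elim)
open import Function using (_∘_; id; mk⇔)
open import Function.Bundles using (module Equivalence)
open import Relation.Nullary using (¬_; Dec; yes; no; does; ¬?)
open import Relation.Nullary.Decidable using (dec-true; dec-false; does-⇔; isYes≗does; _×-dec_)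
open import Relation.Binary.Definitions using (tri<; tri≈; tri>)
open import Relation.Binary.PropositionalEquality using (_≢_; refl; sym; trans; cong; cong₂; subst; subst₂; module ≡-Reasoning)
open import Level using (0ℓ)
open import Algebra.Bundles using (CommutativeRing)
import Algebra.Properties.Ring as RingProperties
open import Algebra.Structures using (IsCommutativeRing)

module Counting where
  open import Data.Nat using (_+_; _*_)
  open import Data.Parity using (_⁻¹)
  open ℙP using (_≟_)

  open import Algebra.Properties.Semiring.Sum NP.+-*-semiring public
    using (sum; sum-syntax; sum-cong-≗; ∑-distrib-+; *-distribˡ-sum; *-distribʳ-sum; sum-permute)

  [_] : Bool → ℕ
  [ true  ] = 1
  [ false ] = 0

  ⟦_⟧ : ∀ {a} {A : Set a} → Dec A → ℕ
  ⟦ a? ⟧ = [ does a? ]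

  [∧] : ∀ a b → [ a ∧ b ] ≡ [ a ] * [ b ]
  [∧] true  b = sym (NP.+-identityʳ [ b ])
  [∧] false b = refl

  module _ {a} {A : Set a} (a? : Dec A) where

    ⟦⟧-yes : A → ⟦ a? ⟧ ≡ 1
    ⟦⟧-yes x = cong [_] (dec-true a? x)

    ⟦⟧-no : ¬ A → ⟦ a? ⟧ ≡ 0
    ⟦⟧-no ¬x = cong [_] (dec-false a? ¬x)

    ⟦⟧+⟦¬⟧ : ⟦ a? ⟧ + ⟦ ¬? a? ⟧ ≡ 1
    ⟦⟧+⟦¬⟧ with does a?
    ... | true  = refl
    ... | false = refl

  ⟦⟧-⇔ : ∀ {a b} {A : Set a} {B : Set b} → A ⇔ B → (a? : Dec A) (b? : Dec B) → ⟦ a? ⟧ ≡ ⟦ b? ⟧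
  ⟦⟧-⇔ A⇔B a? b? = cong [_] (does-⇔ A⇔B a? b?)

  count≡∑ : ∀ {n} {A : Set} (P : A → Bool) (f : Fin n → A) →
            length (filter (λ w → P w Bool.≟ true) (tabulate f)) ≡ ∑[ i < n ] [ P (f i) ]
  count≡∑ {zero}  P f = refl
  count≡∑ {suc n} P f with P (f zero)
  ... | true  = cong suc (count≡∑ P (f ∘ suc))
  ... | false = count≡∑ P (f ∘ suc)

  ∑-select : ∀ {n} (c : Fin n) (f : Fin n → ℕ) → ∑[ x < n ] (⟦ x FP.≟ c ⟧ * f x) ≡ f c
  ∑-select {suc n} zero    f = trans (cong (f zero + 0 +_) (∑-zero n)) (trans (NP.+-identityʳ _) (NP.+-identityʳ _))
    where
    ∑-zero : ∀ n → ∑[ x < n ] 0 ≡ 0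
    ∑-zero zero    = refl
    ∑-zero (suc n) = ∑-zero n
  ∑-select {suc n} (suc c) f = ∑-select c (f ∘ suc)

  ∑-split-at : ∀ {n} (c : Fin n) (f : Fin n → ℕ) → ∑[ x < n ] f x ≡ f c + ∑[ x < n ] (⟦ ¬? (x FP.≟ c) ⟧ * f x)
  ∑-split-at {n} c f = begin
    ∑[ x < n ] f x                        ≡⟨ sum-cong-≗ split ⟩
    ∑[ x < n ] (at x + off x)             ≡⟨ ∑-distrib-+ at off ⟩
    ∑[ x < n ] at x + ∑[ x < n ] off x    ≡⟨ cong (_+ ∑[ x < n ] off x) (∑-select c f) ⟩
    f c + ∑[ x < n ] off x                ∎
    where
    open ≡-Reasoning
    at off : Fin n → ℕ
    at  x = ⟦ x FP.≟ c ⟧ * f x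
    off x = ⟦ ¬? (x FP.≟ c) ⟧ * f x
    split : ∀ x → f x ≡ at x + off x
    split x = begin
      f x                                      ≡⟨ NP.*-identityˡ (f x) ⟨
      1 * f x                                  ≡⟨ cong (_* f x) (⟦⟧+⟦¬⟧ (x FP.≟ c)) ⟨
      (⟦ x FP.≟ c ⟧ + ⟦ ¬? (x FP.≟ c) ⟧) * f x  ≡⟨ NP.*-distribʳ-+ (f x) ⟦ x FP.≟ c ⟧ ⟦ ¬? (x FP.≟ c) ⟧ ⟩
      at x + off x                             ∎

  ∑-combine : ∀ m n (f : Fin (m * n) → ℕ) → ∑[ k < m * n ] f k ≡ ∑[ i < m ] ∑[ j < n ] f (combine i j)
  ∑-combine zero    n f = refl
  ∑-combine (suc m) n f = trans (∑-++ n f) (cong (∑[ j < n ] f (j ↑ˡ (m * n)) +_) (∑-combine m n (f ∘ (n ↑ʳ_))))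
    where
    ∑-++ : ∀ m {k} (f : Fin (m + k) → ℕ) → sum f ≡ ∑[ i < m ] f (i ↑ˡ k) + ∑[ j < k ] f (m ↑ʳ j)
    ∑-++ zero    f = refl
    ∑-++ (suc m) f = trans (cong (f zero +_) (∑-++ m (f ∘ suc))) (sym (NP.+-assoc (f zero) _ _))

  ∑-bijection : ∀ {n} (f : Fin n → ℕ) (g g⁻¹ : Fin n → Fin n) →
                (∀ y → g (g⁻¹ y) ≡ y) → (∀ x → g⁻¹ (g x) ≡ x) → ∑[ x < n ] f (g x) ≡ ∑[ x < n ] f x
  ∑-bijection f g g⁻¹ inv₁ inv₂ = sym (sum-permute f (permutation g g⁻¹ inv₁ inv₂))

  ∑ₚ : (Parity → ℕ) → ℕ
  ∑ₚ f = f 0ℙ + f 1ℙ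

  ∑ₚ-cong : ∀ {f g : Parity → ℕ} → (∀ e → f e ≡ g e) → ∑ₚ f ≡ ∑ₚ g
  ∑ₚ-cong f≗g = cong₂ _+_ (f≗g 0ℙ) (f≗g 1ℙ)

  ⟦≟⟧-sym : ∀ p r → ⟦ p ≟ r ⟧ ≡ ⟦ r ≟ p ⟧
  ⟦≟⟧-sym 0ℙ 0ℙ = refl
  ⟦≟⟧-sym 0ℙ 1ℙ = refl
  ⟦≟⟧-sym 1ℙ 0ℙ = refl
  ⟦≟⟧-sym 1ℙ 1ℙ = refl

  ⟦≟⟧*⟦≟⟧ : ∀ p e d → ⟦ p ≟ e ⟧ * ⟦ p ≟ d ⟧ ≡ ⟦ e ≟ d ⟧ * ⟦ p ≟ e ⟧
  ⟦≟⟧*⟦≟⟧ 0ℙ 0ℙ 0ℙ = refl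
  ⟦≟⟧*⟦≟⟧ 0ℙ 0ℙ 1ℙ = refl
  ⟦≟⟧*⟦≟⟧ 0ℙ 1ℙ 0ℙ = refl
  ⟦≟⟧*⟦≟⟧ 0ℙ 1ℙ 1ℙ = refl
  ⟦≟⟧*⟦≟⟧ 1ℙ 0ℙ 0ℙ = refl
  ⟦≟⟧*⟦≟⟧ 1ℙ 0ℙ 1ℙ = refl
  ⟦≟⟧*⟦≟⟧ 1ℙ 1ℙ 0ℙ = refl
  ⟦≟⟧*⟦≟⟧ 1ℙ 1ℙ 1ℙ = refl

  ⟦≟⟧-partition : ∀ p → ⟦ p ≟ 0ℙ ⟧ + ⟦ p ≟ 1ℙ ⟧ ≡ 1
  ⟦≟⟧-partition 0ℙ = refl
  ⟦≟⟧-partition 1ℙ = refl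

  ⟦≟⟧+⟦⁻¹≟⟧ : ∀ p e → ⟦ p ≟ e ⟧ + ⟦ p ⁻¹ ≟ e ⟧ ≡ 1
  ⟦≟⟧+⟦⁻¹≟⟧ 0ℙ 0ℙ = refl
  ⟦≟⟧+⟦⁻¹≟⟧ 0ℙ 1ℙ = refl
  ⟦≟⟧+⟦⁻¹≟⟧ 1ℙ 0ℙ = refl
  ⟦≟⟧+⟦⁻¹≟⟧ 1ℙ 1ℙ = refl

  ⟦≟⟧-decompose : ∀ p (g : Parity → ℕ) → g p ≡ ∑ₚ (λ e → ⟦ p ≟ e ⟧ * g e)
  ⟦≟⟧-decompose 0ℙ g = trans (sym (NP.+-identityʳ (g 0ℙ))) (sym (NP.+-identityʳ (g 0ℙ + 0)))
  ⟦≟⟧-decompose 1ℙ g = sym (NP.+-identityʳ (g 1ℙ))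

  ∑-fibres : ∀ {n} (p : Fin n → Parity) (G : Fin n → Parity → ℕ) →
             ∑[ x < n ] G x (p x) ≡ ∑ₚ (λ e → ∑[ x < n ] (⟦ p x ≟ e ⟧ * G x e))
  ∑-fibres p G = trans (sum-cong-≗ (λ x → ⟦≟⟧-decompose (p x) (G x)))
                       (∑-distrib-+ (λ x → ⟦ p x ≟ 0ℙ ⟧ * G x 0ℙ) (λ x → ⟦ p x ≟ 1ℙ ⟧ * G x 1ℙ))

  ∑-alternating : ∀ n (g : ℕ → ℕ) → (∀ k → g k + g (suc k) ≡ 1) → ∑[ i < n + n ] g (F.toℕ i) ≡ n
  ∑-alternating zero    g alternates = refl
  ∑-alternating (suc n) g alternates = begin
    g 0 + ∑[ i < n + suc n ] g (suc (F.toℕ i))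
      ≡⟨ cong (λ k → g 0 + ∑[ i < k ] g (suc (F.toℕ i))) (NP.+-suc n n) ⟩
    g 0 + (g 1 + ∑[ i < n + n ] g (suc (suc (F.toℕ i))))
      ≡⟨ NP.+-assoc (g 0) (g 1) _ ⟨
    g 0 + g 1 + ∑[ i < n + n ] g (suc (suc (F.toℕ i)))
      ≡⟨ cong₂ _+_ (alternates 0) (∑-alternating n (λ k → g (suc (suc k))) (λ k → alternates (suc (suc k)))) ⟩
    suc n ∎
    where open ≡-Reasoning

  %2-parity : ∀ m → m % 2 ≡ ⟦ parity m ≟ 1ℙ ⟧
  %2-parity zero          = refl
  %2-parity (suc zero)    = refl
  %2-parity (suc (suc m)) = %2-parity m

  parity≡⇔%2≡ : ∀ {m n} → parity m ≡ parity n ⇔ m % 2 ≡ n % 2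
  parity≡⇔%2≡ {m} {n} = mk⇔
    (λ eq → trans (%2-parity m) (trans (cong (λ p → ⟦ p ≟ 1ℙ ⟧) eq) (sym (%2-parity n))))
    (λ eq → ⟦≟1⟧-injective (parity m) (parity n) (trans (sym (%2-parity m)) (trans eq (%2-parity n))))
    where
    ⟦≟1⟧-injective : ∀ p r → ⟦ p ≟ 1ℙ ⟧ ≡ ⟦ r ≟ 1ℙ ⟧ → p ≡ r
    ⟦≟1⟧-injective 0ℙ 0ℙ _ = refl
    ⟦≟1⟧-injective 1ℙ 1ℙ _ = refl

module CyclotomicArithmetic where
  open import Data.Nat using (_+_; _*_)
  open import Data.Parity using (_⁻¹)
  open Counting
  open ℙP using (_≟_)

  ⟨_,_⟩ : (Parity → Parity → ℕ) → (Parity → Parity → ℕ) → ℕ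
  ⟨ M , Φ ⟩ = ∑ₚ λ e → ∑ₚ λ d → M e d * Φ e d

  ⟨⟩-congʳ : ∀ M {Φ Ψ} → (∀ e d → Φ e d ≡ Ψ e d) → ⟨ M , Φ ⟩ ≡ ⟨ M , Ψ ⟩
  ⟨⟩-congʳ M Φ≗Ψ = cong₂ _+_ (cong₂ _+_ (eq 0ℙ 0ℙ) (eq 0ℙ 1ℙ)) (cong₂ _+_ (eq 1ℙ 0ℙ) (eq 1ℙ 1ℙ))
    where eq = λ e d → cong (M e d *_) (Φ≗Ψ e d)

  ⟨⟩-congˡ : ∀ {M L} Φ → (∀ e d → M e d ≡ L e d) → ⟨ M , Φ ⟩ ≡ ⟨ L , Φ ⟩
  ⟨⟩-congˡ Φ M≗L = cong₂ _+_ (cong₂ _+_ (eq 0ℙ 0ℙ) (eq 0ℙ 1ℙ)) (cong₂ _+_ (eq 1ℙ 0ℙ) (eq 1ℙ 1ℙ))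
    where eq = λ e d → cong (_* Φ e d) (M≗L e d)

  shift : Parity → (Parity → Parity → ℕ) → Parity → Parity → ℕ
  shift η M e d = M (η ℙ.+ e) (η ℙ.+ d)

  ⟨⟩-shift : ∀ η M Φ → ⟨ M , Φ ⟩ ≡ ⟨ shift η M , shift η Φ ⟩
  ⟨⟩-shift 0ℙ M Φ = refl
  ⟨⟩-shift 1ℙ M Φ =
    reverse (M 0ℙ 0ℙ * Φ 0ℙ 0ℙ) (M 0ℙ 1ℙ * Φ 0ℙ 1ℙ) (M 1ℙ 0ℙ * Φ 1ℙ 0ℙ) (M 1ℙ 1ℙ * Φ 1ℙ 1ℙ)
    where
    reverse : ∀ a b c d → (a + b) + (c + d) ≡ (d + c) + (b + a)
    reverse = solve-∀

  ⟦≟⟧-shift : ∀ η p r → ⟦ η ℙ.+ p ≟ η ℙ.+ r ⟧ ≡ ⟦ p ≟ r ⟧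
  ⟦≟⟧-shift 0ℙ p  r  = refl
  ⟦≟⟧-shift 1ℙ 0ℙ 0ℙ = refl
  ⟦≟⟧-shift 1ℙ 0ℙ 1ℙ = refl
  ⟦≟⟧-shift 1ℙ 1ℙ 0ℙ = refl
  ⟦≟⟧-shift 1ℙ 1ℙ 1ℙ = refl

  -- The row, column and diagonal sums of the cyclotomic numbers N e d = #{x ∉ {0, a} : χ x = e, χ (x - a) = d}
  -- of some a ≠ 0 in GF(2h + 1), where π = χ (-1) and η = χ a; they determine N.
  record CyclotomicSystem (h : ℕ) (π η : Parity) (N : Parity → Parity → ℕ) : Set where
    field
      row  : ∀ e → N e 0ℙ + N e 1ℙ + ⟦ η ≟ e ⟧ ≡ h
      col  : ∀ d → N 0ℙ d + N 1ℙ d + ⟦ π ℙ.+ η ≟ d ⟧ ≡ h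
      diag : N 0ℙ 0ℙ + N 1ℙ 1ℙ + 1 ≡ h

  shift-system : ∀ {h π η N} → CyclotomicSystem h π η N → CyclotomicSystem h π 0ℙ (shift η N)
  shift-system {η = 0ℙ} S = S
  shift-system {h} {π} {1ℙ} {N} S =
    record { row = row′ ; col = col′ ; diag = swap (N 0ℙ 0ℙ) (N 1ℙ 1ℙ) diag }
    where
    open CyclotomicSystem S
    swap : ∀ a b {c} → a + b + c ≡ h → b + a + c ≡ h
    swap a b {c} = trans (cong (_+ c) (NP.+-comm b a))
    row′ : ∀ e → N (e ⁻¹) 1ℙ + N (e ⁻¹) 0ℙ + ⟦ 0ℙ ≟ e ⟧ ≡ h
    row′ 0ℙ = swap (N 1ℙ 0ℙ) (N 1ℙ 1ℙ) (row 1ℙ)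
    row′ 1ℙ = swap (N 0ℙ 0ℙ) (N 0ℙ 1ℙ) (row 0ℙ)
    flip : ∀ p d → ⟦ p ℙ.+ 1ℙ ≟ d ⁻¹ ⟧ ≡ ⟦ p ℙ.+ 0ℙ ≟ d ⟧
    flip 0ℙ 0ℙ = refl
    flip 0ℙ 1ℙ = refl
    flip 1ℙ 0ℙ = refl
    flip 1ℙ 1ℙ = refl
    col′ : ∀ d → N 1ℙ (d ⁻¹) + N 0ℙ (d ⁻¹) + ⟦ π ℙ.+ 0ℙ ≟ d ⟧ ≡ h
    col′ d = swap (N 0ℙ (d ⁻¹)) (N 1ℙ (d ⁻¹))
                  (trans (cong (N 0ℙ (d ⁻¹) + N 1ℙ (d ⁻¹) +_) (sym (flip π d))) (col (d ⁻¹)))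

  solution : Parity → ℕ → Parity → Parity → ℕ
  solution 0ℙ m 0ℙ 0ℙ = m
  solution 0ℙ m _  _  = suc m
  solution 1ℙ m 1ℙ 0ℙ = suc m
  solution 1ℙ m _  _  = m

  height : Parity → ℕ → ℕ
  height 0ℙ m = suc m + suc m
  height 1ℙ m = suc (m + m)

  private
    +-cancel-middle : ∀ a {x y} c → a + x + c ≡ a + y + c → x ≡ y
    +-cancel-middle a {x} {y} c eq = NP.+-cancelˡ-≡ a x y (NP.+-cancelʳ-≡ c (a + x) (a + y) eq)

  solve-system : ∀ {h π N} → CyclotomicSystem h π 0ℙ N →
                 ∃[ m ] (h ≡ height π m × ∀ e d → N e d ≡ solution π m e d)
  solve-system {h} {0ℙ} {N} S = m , h≡ , values
    where
    open CyclotomicSystem S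
    m = N 0ℙ 0ℙ
    N₀₁≡N₁₁ : N 0ℙ 1ℙ ≡ N 1ℙ 1ℙ
    N₀₁≡N₁₁ = +-cancel-middle m 1 (trans (row 0ℙ) (sym diag))
    N₁₀≡N₁₁ : N 1ℙ 0ℙ ≡ N 1ℙ 1ℙ
    N₁₀≡N₁₁ = trans (+-cancel-middle m 1 (trans (col 0ℙ) (sym (row 0ℙ)))) N₀₁≡N₁₁
    N₁₁≡1+m : N 1ℙ 1ℙ ≡ suc m
    N₁₁≡1+m = sym (NP.+-cancelˡ-≡ (N 1ℙ 1ℙ) (suc m) (N 1ℙ 1ℙ) (begin
      N 1ℙ 1ℙ + suc m      ≡⟨ rearrange m (N 1ℙ 1ℙ) ⟩
      m + N 1ℙ 1ℙ + 1      ≡⟨ diag ⟩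
      h                    ≡⟨ sym (row 1ℙ) ⟩
      N 1ℙ 0ℙ + N 1ℙ 1ℙ + 0 ≡⟨ cong (λ k → k + N 1ℙ 1ℙ + 0) N₁₀≡N₁₁ ⟩
      N 1ℙ 1ℙ + N 1ℙ 1ℙ + 0 ≡⟨ NP.+-identityʳ _ ⟩
      N 1ℙ 1ℙ + N 1ℙ 1ℙ    ∎))
      where
      open ≡-Reasoning
      rearrange : ∀ m n → n + suc m ≡ m + n + 1
      rearrange = solve-∀
    h≡ : h ≡ suc m + suc m
    h≡ = trans (sym (row 1ℙ)) (trans (NP.+-identityʳ _) (cong₂ _+_ (trans N₁₀≡N₁₁ N₁₁≡1+m) N₁₁≡1+m))
    values : ∀ e d → N e d ≡ solution 0ℙ m e d
    values 0ℙ 0ℙ = refl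
    values 0ℙ 1ℙ = trans N₀₁≡N₁₁ N₁₁≡1+m
    values 1ℙ 0ℙ = trans N₁₀≡N₁₁ N₁₁≡1+m
    values 1ℙ 1ℙ = N₁₁≡1+m
  solve-system {h} {1ℙ} {N} S = m , h≡ , values
    where
    open CyclotomicSystem S
    m = N 0ℙ 0ℙ
    N₀₁≡N₁₁ : N 0ℙ 1ℙ ≡ N 1ℙ 1ℙ
    N₀₁≡N₁₁ = +-cancel-middle m 1 (trans (row 0ℙ) (sym diag))
    N₁₁≡m : N 1ℙ 1ℙ ≡ m
    N₁₁≡m = +-cancel-middle (N 0ℙ 1ℙ) 1 (trans (col 1ℙ) (trans (sym (row 0ℙ)) (cong (_+ 1) (NP.+-comm m (N 0ℙ 1ℙ)))))
    h≡ : h ≡ suc (m + m)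
    h≡ = trans (sym diag) (trans (cong (λ k → m + k + 1) N₁₁≡m) (NP.+-comm (m + m) 1))
    N₁₀≡1+m : N 1ℙ 0ℙ ≡ suc m
    N₁₀≡1+m = NP.+-cancelˡ-≡ m (N 1ℙ 0ℙ) (suc m)
      (trans (sym (NP.+-identityʳ _)) (trans (col 0ℙ) (trans h≡ (sym (NP.+-suc m m)))))
    values : ∀ e d → N e d ≡ solution 1ℙ m e d
    values 0ℙ 0ℙ = refl
    values 0ℙ 1ℙ = trans N₀₁≡N₁₁ N₁₁≡m
    values 1ℙ 0ℙ = N₁₀≡1+m
    values 1ℙ 1ℙ = N₁₁≡m

  -- Given χ₁ x = e and χ₁ (x - a) = d, the number of y for which (x , y) is a common neighbour of (0 , 0) and
  -- (a , b): weightC₁ h₂ when b = 0, and weightD₀ (χ₂ (-1)) (χ₂ b) N₂ when b ≠ 0, with N₂ the cyclotomic numbers of b.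
  weightC₁ : ℕ → Parity → Parity → ℕ
  weightC₁ k e d = 1 + ⟦ e ≟ d ⟧ * k

  weightD₀ : Parity → Parity → (Parity → Parity → ℕ) → Parity → Parity → ℕ
  weightD₀ π η M e d = ⟦ π ℙ.+ η ≟ d ⟧ + ⟦ η ≟ e ⟧ + M e d

  -- The pairings with explicit solutions are written out below, so that the ring solver applies.
  private
    C₁-identity : ∀ π m k → ⟨ solution π m , weightC₁ k ⟩ + k + 1 ≡ height π m + height π m + height π m * k
    C₁-identity 0ℙ = h-even
      where
      h-even : ∀ m k → (m * (1 + 1 * k) + suc m * (1 + 0 * k)) + (suc m * (1 + 0 * k) + suc m * (1 + 1 * k)) + k + 1
                         ≡ (suc m + suc m) + (suc m + suc m) + (suc m + suc m) * k
      h-even = solve-∀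
    C₁-identity 1ℙ = h-odd
      where
      h-odd : ∀ m k → (m * (1 + 1 * k) + m * (1 + 0 * k)) + (suc m * (1 + 0 * k) + m * (1 + 1 * k)) + k + 1
                         ≡ suc (m + m) + suc (m + m) + suc (m + m) * k
      h-odd = solve-∀

    D₀-identity : ∀ π m₁ m₂ → 2 * ⟨ solution π m₁ , weightD₀ π 0ℙ (solution π m₂) ⟩ + height π m₁
                              ≡ 2 * ⟨ solution π m₁ , weightC₁ (height π m₂) ⟩ + height π m₂
    D₀-identity 0ℙ = h-even
      where
      h-even : ∀ m₁ m₂ →
        2 * ((m₁ * (1 + 1 + m₂) + suc m₁ * (0 + 1 + suc m₂)) + (suc m₁ * (1 + 0 + suc m₂) + suc m₁ * (0 + 0 + suc m₂)))
          + (suc m₁ + suc m₁)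
        ≡ 2 * ((m₁ * (1 + 1 * (suc m₂ + suc m₂)) + suc m₁ * (1 + 0 * (suc m₂ + suc m₂)))
               + (suc m₁ * (1 + 0 * (suc m₂ + suc m₂)) + suc m₁ * (1 + 1 * (suc m₂ + suc m₂))))
          + (suc m₂ + suc m₂)
      h-even = solve-∀
    D₀-identity 1ℙ = h-odd
      where
      h-odd : ∀ m₁ m₂ →
        2 * ((m₁ * (0 + 1 + m₂) + m₁ * (1 + 1 + m₂)) + (suc m₁ * (0 + 0 + suc m₂) + m₁ * (1 + 0 + m₂)))
          + suc (m₁ + m₁)
        ≡ 2 * ((m₁ * (1 + 1 * suc (m₂ + m₂)) + m₁ * (1 + 0 * suc (m₂ + m₂)))
               + (suc m₁ * (1 + 0 * suc (m₂ + m₂)) + m₁ * (1 + 1 * suc (m₂ + m₂))))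
          + suc (m₂ + m₂)
      h-odd = solve-∀

  ⟨⟩-shift-C₁ : ∀ η M k → ⟨ M , weightC₁ k ⟩ ≡ ⟨ shift η M , weightC₁ k ⟩
  ⟨⟩-shift-C₁ η M k = trans (⟨⟩-shift η M (weightC₁ k))
    (⟨⟩-congʳ (shift η M) (λ e d → cong (λ t → 1 + t * k) (⟦≟⟧-shift η e d)))

  ⟨⟩-shift-D₀ : ∀ π η M L → ⟨ M , weightD₀ π η L ⟩ ≡ ⟨ shift η M , weightD₀ π 0ℙ (shift η L) ⟩
  ⟨⟩-shift-D₀ π η M L = trans (⟨⟩-shift η M (weightD₀ π η L))
    (⟨⟩-congʳ (shift η M) (λ e d → cong₂ (λ s t → s + t + shift η L e d) (col-term d) (row-term e)))
    where
    col-term : ∀ d → ⟦ π ℙ.+ η ≟ η ℙ.+ d ⟧ ≡ ⟦ π ℙ.+ 0ℙ ≟ d ⟧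
    col-term d =
      trans (cong (λ p → ⟦ p ≟ η ℙ.+ d ⟧) (trans (ℙP.+-comm π η) (cong (η ℙ.+_) (sym (ℙP.+-identityʳ π)))))
            (⟦≟⟧-shift η (π ℙ.+ 0ℙ) d)
    row-term : ∀ e → ⟦ η ≟ η ℙ.+ e ⟧ ≡ ⟦ 0ℙ ≟ e ⟧
    row-term e = trans (cong (λ p → ⟦ p ≟ η ℙ.+ e ⟧) (sym (ℙP.+-identityʳ η))) (⟦≟⟧-shift η 0ℙ e)

  ⟨⟩-C₁ : ∀ {h π η N} k → CyclotomicSystem h π η N → ⟨ N , weightC₁ k ⟩ + k + 1 ≡ h + h + h * k
  ⟨⟩-C₁ {π = π} {η} {N} k S with solve-system (shift-system S)
  ... | m , refl , values = trans (cong (λ t → t + k + 1) ⟨N,w⟩≡) (C₁-identity π m k)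
    where
    ⟨N,w⟩≡ : ⟨ N , weightC₁ k ⟩ ≡ ⟨ solution π m , weightC₁ k ⟩
    ⟨N,w⟩≡ = trans (⟨⟩-shift-C₁ η N k) (⟨⟩-congˡ (weightC₁ k) values)

  ⟨⟩-D₀ : ∀ {h₁ h₂ π η N₁ N₂} → CyclotomicSystem h₁ π η N₁ → CyclotomicSystem h₂ π η N₂ →
          2 * ⟨ N₁ , weightD₀ π η N₂ ⟩ + h₁ ≡ 2 * ⟨ N₁ , weightC₁ h₂ ⟩ + h₂
  ⟨⟩-D₀ {π = π} {η} {N₁} {N₂} S₁ S₂ with solve-system (shift-system S₁) | solve-system (shift-system S₂)
  ... | m₁ , refl , values₁ | m₂ , refl , values₂ =
    trans (cong (λ t → 2 * t + height π m₁) D₀≡)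
          (trans (D₀-identity π m₁ m₂) (cong (λ t → 2 * t + height π m₂) (sym C₁≡)))
    where
    D₀≡ : ⟨ N₁ , weightD₀ π η N₂ ⟩ ≡ ⟨ solution π m₁ , weightD₀ π 0ℙ (solution π m₂) ⟩
    D₀≡ = trans (⟨⟩-shift-D₀ π η N₁ N₂)
           (trans (⟨⟩-congˡ (weightD₀ π 0ℙ (shift η N₂)) values₁)
                  (⟨⟩-congʳ (solution π m₁) (λ e d → cong (⟦ π ℙ.+ 0ℙ ≟ d ⟧ + ⟦ 0ℙ ≟ e ⟧ +_) (values₂ e d))))
    C₁≡ : ⟨ N₁ , weightC₁ (height π m₂) ⟩ ≡ ⟨ solution π m₁ , weightC₁ (height π m₂) ⟩
    C₁≡ = trans (⟨⟩-shift-C₁ η N₁ (height π m₂)) (⟨⟩-congˡ (weightC₁ (height π m₂)) values₁)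

  system-parity : ∀ {h π η N} → CyclotomicSystem h π η N → π ≡ parity h
  system-parity {π = π} S with solve-system (shift-system S)
  ... | m , refl , _ = sym (parity-height π m)
    where
    parity-double : ∀ n → parity (n + n) ≡ 0ℙ
    parity-double n = trans (ℙP.+-homo-+ n n) (ℙP.p+p≡0ℙ (parity n))
    parity-height : ∀ π m → parity (height π m) ≡ π
    parity-height 0ℙ m = parity-double (suc m)
    parity-height 1ℙ m = trans (sym (ℙP.suc-homo-⁻¹ (suc (m + m)))) (cong _⁻¹ (parity-double m))

module FieldProperties {q} (F : FiniteField q) where
  open FiniteField F
  open IsCommutativeRing isCommutativeRing public
    using (+-assoc; +-comm; +-identityˡ; +-identityʳ; -‿inverseˡ; -‿inverseʳ;
           *-assoc; *-comm; *-identityˡ; *-identityʳ; distribʳ; zeroˡ; zeroʳ)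
  private
    commutativeRing : CommutativeRing 0ℓ 0ℓ
    commutativeRing = record { isCommutativeRing = isCommutativeRing }
    module R = RingProperties (CommutativeRing.ring commutativeRing)
  open R public using (-‿involutive; -‿distribˡ-*; +-cancelˡ; -0#≈0#; ⁻¹-anti-homo‿-; -1*x≈-x)
  open R using (x∙y⁻¹≈ε⇒x≈y; x≈y⇒x∙y⁻¹≈ε)
  open Counting
  open ≡-Reasoning

  1≢0 : 1# ≢ 0#
  1≢0 1≡0 = 0≢1 (sym 1≡0)

  *-nonzero : ∀ {x y} → x ≢ 0# → y ≢ 0# → x * y ≢ 0#
  *-nonzero {x} {y} x≢0 y≢0 xy≡0 with inverse x x≢0
  ... | x′ , xx′≡1 = y≢0 (begin
    y              ≡⟨ sym (*-identityˡ y) ⟩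
    1# * y         ≡⟨ cong (_* y) (trans (sym xx′≡1) (*-comm x x′)) ⟩
    (x′ * x) * y   ≡⟨ *-assoc x′ x y ⟩
    x′ * (x * y)   ≡⟨ cong (x′ *_) xy≡0 ⟩
    x′ * 0#        ≡⟨ zeroʳ x′ ⟩
    0#             ∎)

  -‿nonzero : ∀ {x} → x ≢ 0# → - x ≢ 0#
  -‿nonzero {x} x≢0 -x≡0 = x≢0 (trans (sym (-‿involutive x)) (trans (cong -_ -x≡0) -0#≈0#))

  x-y≡0⇔x≡y : ∀ {x y} → (x - y ≡ 0#) ⇔ (x ≡ y)
  x-y≡0⇔x≡y {x} {y} = mk⇔ (x∙y⁻¹≈ε⇒x≈y x y) x≈y⇒x∙y⁻¹≈ε

  x-y≢0⇔x≢y : ∀ {x y} → (x - y ≢ 0#) ⇔ (x ≢ y)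
  x-y≢0⇔x≢y = mk⇔ (λ ne eq → ne (Equivalence.from x-y≡0⇔x≡y eq)) (λ ne eq → ne (Equivalence.to x-y≡0⇔x≡y eq))

  *-cancelˡ : ∀ {a x y} → a ≢ 0# → a * x ≡ a * y → x ≡ y
  *-cancelˡ {a} {x} {y} a≢0 ax≡ay with inverse a a≢0
  ... | a′ , aa′≡1 = trans (undo x) (trans (cong (a′ *_) ax≡ay) (sym (undo y)))
    where
    undo : ∀ z → z ≡ a′ * (a * z)
    undo z = begin
      z              ≡⟨ sym (*-identityˡ z) ⟩
      1# * z         ≡⟨ cong (_* z) (trans (sym aa′≡1) (*-comm a a′)) ⟩
      (a′ * a) * z   ≡⟨ *-assoc a′ a z ⟩
      a′ * (a * z)   ∎

  -- a total inverse, with the junk value 0# ⁻¹ = 0#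
  _⁻¹ : Fin q → Fin q
  x ⁻¹ with x FP.≟ 0#
  ... | yes _   = 0#
  ... | no x≢0  = proj₁ (inverse x x≢0)

  0⁻¹≡0 : 0# ⁻¹ ≡ 0#
  0⁻¹≡0 with 0# FP.≟ 0#
  ... | yes _  = refl
  ... | no 0≢0 = ⊥-elim (0≢0 refl)

  ⁻¹-inverseʳ : ∀ {x} → x ≢ 0# → x * x ⁻¹ ≡ 1#
  ⁻¹-inverseʳ {x} x≢0 with x FP.≟ 0#
  ... | yes x≡0  = ⊥-elim (x≢0 x≡0)
  ... | no x≢0′  = proj₂ (inverse x x≢0′)

  ⁻¹-inverseˡ : ∀ {x} → x ≢ 0# → x ⁻¹ * x ≡ 1#
  ⁻¹-inverseˡ {x} x≢0 = trans (*-comm (x ⁻¹) x) (⁻¹-inverseʳ x≢0)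

  ⁻¹-nonzero : ∀ {x} → x ≢ 0# → x ⁻¹ ≢ 0#
  ⁻¹-nonzero {x} x≢0 x⁻¹≡0 = 1≢0 (trans (sym (⁻¹-inverseʳ x≢0)) (trans (cong (x *_) x⁻¹≡0) (zeroʳ x)))

  ⁻¹-unique : ∀ {x y} → x * y ≡ 1# → y ≡ x ⁻¹
  ⁻¹-unique {x} {y} xy≡1 = *-cancelˡ x≢0 (trans xy≡1 (sym (⁻¹-inverseʳ x≢0)))
    where
    x≢0 : x ≢ 0#
    x≢0 x≡0 = 1≢0 (trans (sym xy≡1) (trans (cong (_* y) x≡0) (zeroˡ y)))

  ⁻¹-involutive : ∀ x → x ⁻¹ ⁻¹ ≡ x
  ⁻¹-involutive x = by-cases (x FP.≟ 0#)
    where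
    by-cases : Dec (x ≡ 0#) → x ⁻¹ ⁻¹ ≡ x
    by-cases (yes x≡0) = trans (cong (λ t → t ⁻¹ ⁻¹) x≡0) (trans (cong _⁻¹ 0⁻¹≡0) (trans 0⁻¹≡0 (sym x≡0)))
    by-cases (no x≢0)  = sym (⁻¹-unique (⁻¹-inverseˡ x≢0))

  x+y-y≡x : ∀ x y → (x + y) - y ≡ x
  x+y-y≡x x y = trans (+-assoc x y (- y)) (trans (cong (x +_) (-‿inverseʳ y)) (+-identityʳ x))

  x-y+y≡x : ∀ x y → (x - y) + y ≡ x
  x-y+y≡x x y = trans (+-assoc x (- y) y) (trans (cong (x +_) (-‿inverseˡ y)) (+-identityʳ x))

  x-0≡x : ∀ x → x - 0# ≡ x
  x-0≡x x = trans (cong (x +_) -0#≈0#) (+-identityʳ x)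

  [x+u]-v≡x-[v-u] : ∀ x u v → (x + u) - v ≡ x - (v - u)
  [x+u]-v≡x-[v-u] x u v = begin
    (x + u) + - v     ≡⟨ +-assoc x u (- v) ⟩
    x + (u + - v)     ≡⟨ cong (x +_) (sym (⁻¹-anti-homo‿- v u)) ⟩
    x + - (v - u)     ∎

  ∑-translate : ∀ c (f : Fin q → ℕ) → ∑[ x < q ] f (x + c) ≡ ∑[ x < q ] f x
  ∑-translate c f = ∑-bijection f (_+ c) (_- c) (λ y → x-y+y≡x y c) (λ x → x+y-y≡x x c)

  ∑-affine : ∀ {m} → m ≢ 0# → ∀ c (f : Fin q → ℕ) → ∑[ x < q ] f (c + m * x) ≡ ∑[ x < q ] f x
  ∑-affine {m} m≢0 c f = ∑-bijection f (λ x → c + m * x) (λ y → m ⁻¹ * (y - c)) forth back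
    where
    forth : ∀ y → c + m * (m ⁻¹ * (y - c)) ≡ y
    forth y = begin
      c + m * (m ⁻¹ * (y - c))  ≡⟨ cong (c +_) (sym (*-assoc m (m ⁻¹) (y - c))) ⟩
      c + (m * m ⁻¹) * (y - c)  ≡⟨ cong (λ t → c + t * (y - c)) (⁻¹-inverseʳ m≢0) ⟩
      c + 1# * (y - c)          ≡⟨ cong (c +_) (*-identityˡ (y - c)) ⟩
      c + (y - c)               ≡⟨ +-comm c (y - c) ⟩
      (y - c) + c               ≡⟨ x-y+y≡x y c ⟩
      y                         ∎
    back : ∀ x → m ⁻¹ * ((c + m * x) - c) ≡ x
    back x = begin
      m ⁻¹ * ((c + m * x) - c)  ≡⟨ cong (λ t → m ⁻¹ * (t - c)) (+-comm c (m * x)) ⟩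
      m ⁻¹ * ((m * x + c) - c)  ≡⟨ cong (m ⁻¹ *_) (x+y-y≡x (m * x) c) ⟩
      m ⁻¹ * (m * x)            ≡⟨ sym (*-assoc (m ⁻¹) m x) ⟩
      (m ⁻¹ * m) * x            ≡⟨ cong (_* x) (⁻¹-inverseˡ m≢0) ⟩
      1# * x                    ≡⟨ *-identityˡ x ⟩
      x                         ∎

  ∑-⁻¹ : ∀ (f : Fin q → ℕ) → ∑[ x < q ] f (x ⁻¹) ≡ ∑[ x < q ] f x
  ∑-⁻¹ f = ∑-bijection f _⁻¹ _⁻¹ ⁻¹-involutive ⁻¹-involutive

least-satisfying : ∀ {p} {P : ℕ → Set p} → (∀ n → Dec (P n)) → ∀ {n} → P n →
                   ∃[ m ] (P m × ∀ {k} → k < m → ¬ P k)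
least-satisfying {P = P} P? {n} pn = search 0 n (λ ()) pn
  where
  search : ∀ m fuel → (∀ {k} → k < m → ¬ P k) → P (m ℕ.+ fuel) → ∃[ m ] (P m × ∀ {k} → k < m → ¬ P k)
  search m zero        below p = m , subst P (NP.+-identityʳ m) p , below
  search m (suc fuel)  below p with P? m
  ... | yes pm = m , pm , below
  ... | no ¬pm = search (suc m) fuel below′ (subst P (NP.+-suc m fuel) p)
    where
    below′ : ∀ {k} → k < suc m → ¬ P k
    below′ k<1+m with NP.m<1+n⇒m<n∨m≡n k<1+m
    ... | inj₁ k<m  = below k<m
    ... | inj₂ refl = ¬pm

module PrimitiveElement {q} (F : FiniteField q) (α : Fin q) (α-primitive : FiniteField.IsPrimitive F α) where
  open FiniteField F
  open FieldProperties F
  open Counting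
  open ≡-Reasoning

  ^-+ : ∀ x i j → x ^ (i ℕ.+ j) ≡ x ^ i * x ^ j
  ^-+ x zero    j = sym (*-identityˡ _)
  ^-+ x (suc i) j = trans (cong (x *_) (^-+ x i j)) (sym (*-assoc x _ _))

  α^-nonzero : ∀ k → α ^ k ≢ 0#
  α^-nonzero zero    = 1≢0
  α^-nonzero (suc k) = *-nonzero (proj₁ α-primitive) (α^-nonzero k)

  IsPeriod : ℕ → Set
  IsPeriod k = 0 < k × α ^ k ≡ 1#

  period-of-equal-powers : ∀ {i j} → i < j → α ^ i ≡ α ^ j → IsPeriod (j ∸ i)
  period-of-equal-powers {i} {j} i<j αⁱ≡αʲ = NP.m<n⇒0<n∸m i<j , *-cancelˡ (α^-nonzero i) (begin
    α ^ i * α ^ (j ∸ i)   ≡⟨ sym (^-+ α i (j ∸ i)) ⟩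
    α ^ (i ℕ.+ (j ∸ i))     ≡⟨ cong (α ^_) (NP.m+[n∸m]≡n (NP.<⇒≤ i<j)) ⟩
    α ^ j                 ≡⟨ sym αⁱ≡αʲ ⟩
    α ^ i                 ≡⟨ sym (*-identityʳ _) ⟩
    α ^ i * 1#            ∎)

  opaque
    order-spec : ∃[ d ] (IsPeriod d × ∀ {k} → k < d → ¬ IsPeriod k)
    order-spec with FP.pigeonhole (NP.n<1+n q) (λ (i : Fin (suc q)) → α ^ toℕ i)
    ... | i , j , i<j , αⁱ≡αʲ =
      least-satisfying (λ k → (0 ℕ.<? k) ×-dec (α ^ k FP.≟ 1#)) (period-of-equal-powers i<j αⁱ≡αʲ)

  order : ℕ
  order = proj₁ order-spec

  0<order : 0 < order
  0<order = proj₁ (proj₁ (proj₂ order-spec))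

  α^order≡1 : α ^ order ≡ 1#
  α^order≡1 = proj₂ (proj₁ (proj₂ order-spec))

  minimal : ∀ {k} → k < order → ¬ IsPeriod k
  minimal = proj₂ (proj₂ order-spec)

  instance
    order-nonZero : NonZero order
    order-nonZero = >-nonZero 0<order

  α^-injective : ∀ {i j} → i < order → j < order → α ^ i ≡ α ^ j → i ≡ j
  α^-injective {i} {j} i<d j<d αⁱ≡αʲ with NP.<-cmp i j
  ... | tri≈ _ i≡j _ = i≡j
  ... | tri< i<j _ _ = ⊥-elim (minimal (NP.≤-<-trans (NP.m∸n≤m j i) j<d) (period-of-equal-powers i<j αⁱ≡αʲ))
  ... | tri> _ _ j<i = ⊥-elim (minimal (NP.≤-<-trans (NP.m∸n≤m i j) i<d) (period-of-equal-powers j<i (sym αⁱ≡αʲ)))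

  α^-mod : ∀ k → α ^ k ≡ α ^ (k % order)
  α^-mod k = begin
    α ^ k                                      ≡⟨ cong (α ^_) (m≡m%n+[m/n]*n k order) ⟩
    α ^ (k % order ℕ.+ (k / order) ℕ.* order)      ≡⟨ ^-+ α (k % order) _ ⟩
    α ^ (k % order) * α ^ ((k / order) ℕ.* order) ≡⟨ cong (α ^ (k % order) *_) (α^-multiple (k / order)) ⟩
    α ^ (k % order) * 1#                       ≡⟨ *-identityʳ _ ⟩
    α ^ (k % order)                            ∎
    where
    α^-multiple : ∀ t → α ^ (t ℕ.* order) ≡ 1#
    α^-multiple zero    = refl
    α^-multiple (suc t) =
      trans (^-+ α order (t ℕ.* order)) (trans (cong₂ _*_ α^order≡1 (α^-multiple t)) (*-identityˡ 1#))

  log : ∀ x → x ≢ 0# → Fin order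
  log x x≢0 = fromℕ< (m%n<n (proj₁ (proj₂ α-primitive x x≢0)) order)

  α^log : ∀ {x} (x≢0 : x ≢ 0#) → α ^ toℕ (log x x≢0) ≡ x
  α^log {x} x≢0 with proj₂ α-primitive x x≢0
  ... | k , x≡αᵏ = trans (cong (α ^_) (FP.toℕ-fromℕ< (m%n<n k order))) (sym (trans x≡αᵏ (α^-mod k)))

  exp : Fin (suc order) → Fin q
  exp zero    = 0#
  exp (suc i) = α ^ toℕ i

  exp⁻¹ : Fin q → Fin (suc order)
  exp⁻¹ x with x FP.≟ 0#
  ... | yes _   = zero
  ... | no x≢0  = suc (log x x≢0)

  exp-exp⁻¹ : ∀ x → exp (exp⁻¹ x) ≡ x
  exp-exp⁻¹ x with x FP.≟ 0#
  ... | yes x≡0 = sym x≡0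
  ... | no x≢0  = α^log x≢0

  exp⁻¹-exp : ∀ i → exp⁻¹ (exp i) ≡ i
  exp⁻¹-exp zero with 0# FP.≟ 0#
  ... | yes _  = refl
  ... | no 0≢0 = ⊥-elim (0≢0 refl)
  exp⁻¹-exp (suc i) with α ^ toℕ i FP.≟ 0#
  ... | yes αⁱ≡0 = ⊥-elim (α^-nonzero (toℕ i) αⁱ≡0)
  ... | no αⁱ≢0  = cong suc (FP.toℕ-injective (α^-injective (FP.toℕ<n _) (FP.toℕ<n i) (α^log αⁱ≢0)))

  exp-permutation : Permutation (suc order) q
  exp-permutation = permutation exp exp⁻¹ exp-exp⁻¹ exp⁻¹-exp

  suc-order≡q : suc order ≡ q
  suc-order≡q with suc order ℕ.≟ q
  ... | yes eq = eq
  ... | no ne  = ⊥-elim (Perm.refute ne exp-permutation)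

  ∑-exp : ∀ (f : Fin q → ℕ) → ∑[ x < q ] f x ≡ f 0# ℕ.+ ∑[ i < order ] f (α ^ toℕ i)
  ∑-exp f = sum-permute f exp-permutation

module QuadraticCharacter {h} (F : FiniteField (suc (h ℕ.+ h))) (α : Fin (suc (h ℕ.+ h)))
                          (α-primitive : FiniteField.IsPrimitive F α) where
  open FiniteField F
  open FieldProperties F
  open PrimitiveElement F α α-primitive
  open Counting
  open CyclotomicArithmetic using (CyclotomicSystem; ⟨_,_⟩; weightC₁; weightD₀)
  open ℙP using (_≟_)
  open ≡-Reasoning

  private
    q : ℕ
    q = suc (h ℕ.+ h)

  order≡h+h : order ≡ h ℕ.+ h
  order≡h+h = NP.suc-injective suc-order≡q

  0<h : 0 < h
  0<h = half-positive h (subst (0 <_) order≡h+h 0<order)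
    where
    half-positive : ∀ m → 0 < m ℕ.+ m → 0 < m
    half-positive (suc m) _ = ℕ.z<s

  discrete-log : ∀ {x} → x ≢ 0# → ∃[ i ] (x ≡ α ^ toℕ {h ℕ.+ h} i)
  discrete-log {x} x≢0 =
    F.cast order≡h+h (log x x≢0) , sym (trans (cong (α ^_) (FP.toℕ-cast order≡h+h (log x x≢0))) (α^log x≢0))

  exponent-parity : Fin (suc order) → Parity
  exponent-parity zero    = 0ℙ
  exponent-parity (suc i) = parity (toℕ i)

  parity-mod-order : ∀ k → parity (k % order) ≡ parity k
  parity-mod-order k = sym (begin
    parity k                                             ≡⟨ cong parity (m≡m%n+[m/n]*n k order) ⟩
    parity (k % order ℕ.+ k / order ℕ.* order)           ≡⟨ ℙP.+-homo-+ (k % order) _ ⟩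
    parity (k % order) ℙ.+ parity (k / order ℕ.* order)  ≡⟨ cong (parity (k % order) ℙ.+_) parity-multiple ⟩
    parity (k % order) ℙ.+ 0ℙ                            ≡⟨ ℙP.+-identityʳ _ ⟩
    parity (k % order)                                   ∎)
    where
    parity-order : parity order ≡ 0ℙ
    parity-order = trans (cong parity order≡h+h) (trans (ℙP.+-homo-+ h h) (ℙP.p+p≡0ℙ (parity h)))
    parity-multiple : parity (k / order ℕ.* order) ≡ 0ℙ
    parity-multiple = begin
      parity (k / order ℕ.* order)         ≡⟨ ℙP.*-homo-* (k / order) order ⟩
      parity (k / order) ℙ.* parity order  ≡⟨ cong (parity (k / order) ℙ.*_) parity-order ⟩
      parity (k / order) ℙ.* 0ℙ            ≡⟨ ℙP.*-zeroʳ _ ⟩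
      0ℙ                                   ∎

  -- The quadratic character, written additively: the parity of the discrete logarithm (junk value 0ℙ at 0#).
  opaque
    χ : Fin q → Parity
    χ x = exponent-parity (exp⁻¹ x)

    χ-α^toℕ : ∀ (i : Fin order) → χ (α ^ toℕ i) ≡ parity (toℕ i)
    χ-α^toℕ i = cong exponent-parity (exp⁻¹-exp (suc i))

  χ-α^ : ∀ k → χ (α ^ k) ≡ parity k
  χ-α^ k = begin
    χ (α ^ k)                   ≡⟨ cong χ (α^-mod k) ⟩
    χ (α ^ (k % order))         ≡⟨ cong (λ t → χ (α ^ t)) (sym (FP.toℕ-fromℕ< r<order)) ⟩
    χ (α ^ toℕ (fromℕ< r<order)) ≡⟨ χ-α^toℕ (fromℕ< r<order) ⟩
    parity (toℕ (fromℕ< r<order)) ≡⟨ cong parity (FP.toℕ-fromℕ< r<order) ⟩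
    parity (k % order)          ≡⟨ parity-mod-order k ⟩
    parity k                    ∎
    where
    r<order = m%n<n k order

  χ-1 : χ 1# ≡ 0ℙ
  χ-1 = χ-α^ 0

  χ-* : ∀ {x y} → x ≢ 0# → y ≢ 0# → χ (x * y) ≡ χ x ℙ.+ χ y
  χ-* {x} {y} x≢0 y≢0 with proj₂ α-primitive x x≢0 | proj₂ α-primitive y y≢0
  ... | i , refl | j , refl = begin
    χ (α ^ i * α ^ j)         ≡⟨ cong χ (sym (^-+ α i j)) ⟩
    χ (α ^ (i ℕ.+ j))         ≡⟨ χ-α^ (i ℕ.+ j) ⟩
    parity (i ℕ.+ j)          ≡⟨ ℙP.+-homo-+ i j ⟩
    parity i ℙ.+ parity j     ≡⟨ sym (cong₂ ℙ._+_ (χ-α^ i) (χ-α^ j)) ⟩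
    χ (α ^ i) ℙ.+ χ (α ^ j)   ∎

  χ-⁻¹ : ∀ {x} → x ≢ 0# → χ (x ⁻¹) ≡ χ x
  χ-⁻¹ {x} x≢0 = ℙP.+-cancelˡ-≡ (χ x) (χ (x ⁻¹)) (χ x) (begin
    χ x ℙ.+ χ (x ⁻¹)  ≡⟨ sym (χ-* x≢0 (⁻¹-nonzero x≢0)) ⟩
    χ (x * x ⁻¹)      ≡⟨ cong χ (⁻¹-inverseʳ x≢0) ⟩
    χ 1#              ≡⟨ χ-1 ⟩
    0ℙ                ≡⟨ sym (ℙP.p+p≡0ℙ (χ x)) ⟩
    χ x ℙ.+ χ x       ∎)

  χ-neg : ∀ {x} → x ≢ 0# → χ (- x) ≡ χ (- 1#) ℙ.+ χ x
  χ-neg {x} x≢0 = trans (cong χ (sym (-1*x≈-x x))) (χ-* (-‿nonzero 1≢0) x≢0)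

  δ ε : Fin q → ℕ
  δ x = ⟦ x FP.≟ 0# ⟧
  ε x = ⟦ ¬? (x FP.≟ 0#) ⟧

  δ-zero : δ 0# ≡ 1
  δ-zero = ⟦⟧-yes (0# FP.≟ 0#) refl

  δ-nonzero : ∀ {x} → x ≢ 0# → δ x ≡ 0
  δ-nonzero {x} = ⟦⟧-no (x FP.≟ 0#)

  ε-zero : ε 0# ≡ 0
  ε-zero = ⟦⟧-no (¬? (0# FP.≟ 0#)) (λ 0≢0 → 0≢0 refl)

  ε-nonzero : ∀ {x} → x ≢ 0# → ε x ≡ 1
  ε-nonzero {x} = ⟦⟧-yes (¬? (x FP.≟ 0#))

  δ-sub : ∀ x y → δ (x - y) ≡ ⟦ x FP.≟ y ⟧
  δ-sub x y = ⟦⟧-⇔ x-y≡0⇔x≡y (x - y FP.≟ 0#) (x FP.≟ y)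

  ε-sub : ∀ x y → ε (x - y) ≡ ⟦ ¬? (x FP.≟ y) ⟧
  ε-sub x y = ⟦⟧-⇔ x-y≢0⇔x≢y (¬? (x - y FP.≟ 0#)) (¬? (x FP.≟ y))

  -- the indicator of the nonzero squares (e = 0ℙ) or of the non-squares (e = 1ℙ)
  inQ : Parity → Fin q → ℕ
  inQ e x = ε x ℕ.* ⟦ χ x ≟ e ⟧

  inQ-zero : ∀ e → inQ e 0# ≡ 0
  inQ-zero e = cong (ℕ._* ⟦ χ 0# ≟ e ⟧) ε-zero

  inQ-nonzero : ∀ {x} → x ≢ 0# → ∀ e → inQ e x ≡ ⟦ χ x ≟ e ⟧
  inQ-nonzero {x} x≢0 e = trans (cong (ℕ._* ⟦ χ x ≟ e ⟧) (ε-nonzero x≢0)) (NP.*-identityˡ _)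

  inQ-partition : ∀ x → inQ 0ℙ x ℕ.+ inQ 1ℙ x ≡ ε x
  inQ-partition x = trans (sym (NP.*-distribˡ-+ (ε x) ⟦ χ x ≟ 0ℙ ⟧ ⟦ χ x ≟ 1ℙ ⟧))
                          (trans (cong (ε x ℕ.*_) (⟦≟⟧-partition (χ x))) (NP.*-identityʳ (ε x)))

  ∑-inQ : ∀ e → ∑[ x < q ] inQ e x ≡ h
  ∑-inQ e = begin
    ∑[ x < q ] inQ e x
      ≡⟨ ∑-exp (inQ e) ⟩
    inQ e 0# ℕ.+ ∑[ i < order ] inQ e (α ^ toℕ i)
      ≡⟨ cong₂ ℕ._+_ (inQ-zero e) (sum-cong-≗ powers) ⟩
    ∑[ i < order ] ⟦ parity (toℕ i) ≟ e ⟧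
      ≡⟨ cong (λ n → ∑[ i < n ] ⟦ parity (toℕ i) ≟ e ⟧) order≡h+h ⟩
    ∑[ i < h ℕ.+ h ] ⟦ parity (toℕ i) ≟ e ⟧
      ≡⟨ ∑-alternating h (λ k → ⟦ parity k ≟ e ⟧) alternates ⟩
    h ∎
    where
    powers : ∀ i → inQ e (α ^ toℕ i) ≡ ⟦ parity (toℕ i) ≟ e ⟧
    powers i = trans (inQ-nonzero (α^-nonzero (toℕ i)) e) (cong (λ p → ⟦ p ≟ e ⟧) (χ-α^toℕ i))
    alternates : ∀ k → ⟦ parity k ≟ e ⟧ ℕ.+ ⟦ parity (suc k) ≟ e ⟧ ≡ 1
    alternates k = trans (cong (λ p → ⟦ parity k ≟ e ⟧ ℕ.+ ⟦ p ≟ e ⟧) (sym (ℙP.suc-homo-⁻¹ (suc k))))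
                         (⟦≟⟧+⟦⁻¹≟⟧ (parity k) e)

  cyclotomic : Fin q → Parity → Parity → ℕ
  cyclotomic a e d = ∑[ x < q ] (inQ e x ℕ.* inQ d (x - a))

  cyclotomic-row : ∀ {a} → a ≢ 0# → ∀ e → cyclotomic a e 0ℙ ℕ.+ cyclotomic a e 1ℙ ℕ.+ ⟦ χ a ≟ e ⟧ ≡ h
  cyclotomic-row {a} a≢0 e = begin
    cyclotomic a e 0ℙ ℕ.+ cyclotomic a e 1ℙ ℕ.+ ⟦ χ a ≟ e ⟧
      ≡⟨ cong₂ ℕ._+_ (sym (∑-distrib-+ (λ x → inQ e x ℕ.* inQ 0ℙ (x - a)) (λ x → inQ e x ℕ.* inQ 1ℙ (x - a))))
                     (sym (inQ-nonzero a≢0 e)) ⟩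
    ∑[ x < q ] (inQ e x ℕ.* inQ 0ℙ (x - a) ℕ.+ inQ e x ℕ.* inQ 1ℙ (x - a)) ℕ.+ inQ e a
      ≡⟨ cong (ℕ._+ inQ e a) (sum-cong-≗ outside-a) ⟩
    ∑[ x < q ] (⟦ ¬? (x FP.≟ a) ⟧ ℕ.* inQ e x) ℕ.+ inQ e a
      ≡⟨ NP.+-comm _ (inQ e a) ⟩
    inQ e a ℕ.+ ∑[ x < q ] (⟦ ¬? (x FP.≟ a) ⟧ ℕ.* inQ e x)
      ≡⟨ sym (∑-split-at a (inQ e)) ⟩
    ∑[ x < q ] inQ e x
      ≡⟨ ∑-inQ e ⟩
    h ∎
    where
    outside-a : ∀ x → inQ e x ℕ.* inQ 0ℙ (x - a) ℕ.+ inQ e x ℕ.* inQ 1ℙ (x - a) ≡ ⟦ ¬? (x FP.≟ a) ⟧ ℕ.* inQ e x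
    outside-a x = begin
      inQ e x ℕ.* inQ 0ℙ (x - a) ℕ.+ inQ e x ℕ.* inQ 1ℙ (x - a) ≡⟨ sym (NP.*-distribˡ-+ (inQ e x) _ _) ⟩
      inQ e x ℕ.* (inQ 0ℙ (x - a) ℕ.+ inQ 1ℙ (x - a))           ≡⟨ cong (inQ e x ℕ.*_) (trans (inQ-partition (x - a)) (ε-sub x a)) ⟩
      inQ e x ℕ.* ⟦ ¬? (x FP.≟ a) ⟧                             ≡⟨ NP.*-comm (inQ e x) _ ⟩
      ⟦ ¬? (x FP.≟ a) ⟧ ℕ.* inQ e x                             ∎

  cyclotomic-col : ∀ {a} → a ≢ 0# → ∀ d →
                   cyclotomic a 0ℙ d ℕ.+ cyclotomic a 1ℙ d ℕ.+ ⟦ χ (- 1#) ℙ.+ χ a ≟ d ⟧ ≡ h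
  cyclotomic-col {a} a≢0 d = begin
    cyclotomic a 0ℙ d ℕ.+ cyclotomic a 1ℙ d ℕ.+ ⟦ χ (- 1#) ℙ.+ χ a ≟ d ⟧
      ≡⟨ cong₂ ℕ._+_ (sym (∑-distrib-+ (λ x → inQ 0ℙ x ℕ.* inQ d (x - a)) (λ x → inQ 1ℙ x ℕ.* inQ d (x - a))))
                     (sym (trans (inQ-nonzero (-‿nonzero a≢0) d) (cong (λ p → ⟦ p ≟ d ⟧) (χ-neg a≢0)))) ⟩
    ∑[ x < q ] (inQ 0ℙ x ℕ.* inQ d (x - a) ℕ.+ inQ 1ℙ x ℕ.* inQ d (x - a)) ℕ.+ inQ d (- a)
      ≡⟨ cong (ℕ._+ inQ d (- a)) (sum-cong-≗ nonzero) ⟩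
    ∑[ x < q ] (ε x ℕ.* inQ d (x - a)) ℕ.+ inQ d (- a)
      ≡⟨ cong (ℕ._+ inQ d (- a)) (sym (∑-translate a (λ x → ε x ℕ.* inQ d (x - a)))) ⟩
    ∑[ y < q ] (ε (y + a) ℕ.* inQ d ((y + a) - a)) ℕ.+ inQ d (- a)
      ≡⟨ cong (ℕ._+ inQ d (- a)) (sum-cong-≗ outside-minus-a) ⟩
    ∑[ y < q ] (⟦ ¬? (y FP.≟ - a) ⟧ ℕ.* inQ d y) ℕ.+ inQ d (- a)
      ≡⟨ NP.+-comm _ (inQ d (- a)) ⟩
    inQ d (- a) ℕ.+ ∑[ y < q ] (⟦ ¬? (y FP.≟ - a) ⟧ ℕ.* inQ d y)
      ≡⟨ sym (∑-split-at (- a) (inQ d)) ⟩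
    ∑[ y < q ] inQ d y
      ≡⟨ ∑-inQ d ⟩
    h ∎
    where
    nonzero : ∀ x → inQ 0ℙ x ℕ.* inQ d (x - a) ℕ.+ inQ 1ℙ x ℕ.* inQ d (x - a) ≡ ε x ℕ.* inQ d (x - a)
    nonzero x = trans (sym (NP.*-distribʳ-+ (inQ d (x - a)) (inQ 0ℙ x) (inQ 1ℙ x)))
                      (cong (ℕ._* inQ d (x - a)) (inQ-partition x))
    outside-minus-a : ∀ y → ε (y + a) ℕ.* inQ d ((y + a) - a) ≡ ⟦ ¬? (y FP.≟ - a) ⟧ ℕ.* inQ d y
    outside-minus-a y = cong₂ ℕ._*_
      (trans (cong (λ t → ε (y + t)) (sym (-‿involutive a))) (ε-sub y (- a)))
      (cong (inQ d) (x+y-y≡x y a))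

  -- x ↦ 1 - a/x maps x ∉ {0, a} to (x - a)/x ∉ {0, 1}, whose character is χ (x - a) + χ x
  module DiagonalSubstitution {a} (a≢0 : a ≢ 0#) where

    g : Fin q → Fin q
    g x = 1# + - a * x ⁻¹

    inQ₀-except-1 : Fin q → ℕ
    inQ₀-except-1 v = ⟦ ¬? (v FP.≟ 1#) ⟧ ℕ.* inQ 0ℙ v

    g-0 : g 0# ≡ 1#
    g-0 = begin
      1# + - a * 0# ⁻¹  ≡⟨ cong (λ t → 1# + - a * t) 0⁻¹≡0 ⟩
      1# + - a * 0#     ≡⟨ cong (1# +_) (zeroʳ (- a)) ⟩
      1# + 0#           ≡⟨ +-identityʳ 1# ⟩
      1#                ∎

    g-a : g a ≡ 0#
    g-a = begin
      1# + - a * a ⁻¹     ≡⟨ cong (1# +_) (sym (-‿distribˡ-* a (a ⁻¹))) ⟩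
      1# + - (a * a ⁻¹)   ≡⟨ cong (λ t → 1# + - t) (⁻¹-inverseʳ a≢0) ⟩
      1# - 1#             ≡⟨ -‿inverseʳ 1# ⟩
      0#                  ∎

    module _ {x} (x≢0 : x ≢ 0#) (x≢a : x ≢ a) where

      x-a≢0 : x - a ≢ 0#
      x-a≢0 = Equivalence.from x-y≢0⇔x≢y x≢a

      g-factor : g x ≡ (x - a) * x ⁻¹
      g-factor = sym (begin
        (x + - a) * x ⁻¹        ≡⟨ distribʳ (x ⁻¹) x (- a) ⟩
        x * x ⁻¹ + - a * x ⁻¹   ≡⟨ cong (_+ - a * x ⁻¹) (⁻¹-inverseʳ x≢0) ⟩
        1# + - a * x ⁻¹         ∎)

      g≢0 : g x ≢ 0#
      g≢0 gx≡0 = *-nonzero x-a≢0 (⁻¹-nonzero x≢0) (trans (sym g-factor) gx≡0)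

      g≢1 : g x ≢ 1#
      g≢1 gx≡1 = *-nonzero (-‿nonzero a≢0) (⁻¹-nonzero x≢0)
        (+-cancelˡ 1# (- a * x ⁻¹) 0# (trans gx≡1 (sym (+-identityʳ 1#))))

      χ-g : χ (g x) ≡ χ (x - a) ℙ.+ χ x
      χ-g = trans (cong χ g-factor) (trans (χ-* x-a≢0 (⁻¹-nonzero x≢0)) (cong (χ (x - a) ℙ.+_) (χ-⁻¹ x≢0)))

    same-character : ∀ x → inQ 0ℙ x ℕ.* inQ 0ℙ (x - a) ℕ.+ inQ 1ℙ x ℕ.* inQ 1ℙ (x - a) ≡ inQ₀-except-1 (g x)
    same-character x = by-cases x (x FP.≟ 0#) (x FP.≟ a)
      where
      agree : ∀ p r → ⟦ p ≟ 0ℙ ⟧ ℕ.* ⟦ r ≟ 0ℙ ⟧ ℕ.+ ⟦ p ≟ 1ℙ ⟧ ℕ.* ⟦ r ≟ 1ℙ ⟧ ≡ 1 ℕ.* ⟦ r ℙ.+ p ≟ 0ℙ ⟧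
      agree 0ℙ 0ℙ = refl
      agree 0ℙ 1ℙ = refl
      agree 1ℙ 0ℙ = refl
      agree 1ℙ 1ℙ = refl
      by-cases : ∀ x → Dec (x ≡ 0#) → Dec (x ≡ a) →
                 inQ 0ℙ x ℕ.* inQ 0ℙ (x - a) ℕ.+ inQ 1ℙ x ℕ.* inQ 1ℙ (x - a) ≡ inQ₀-except-1 (g x)
      by-cases _ (yes refl) _ = begin
        inQ 0ℙ 0# ℕ.* inQ 0ℙ (0# - a) ℕ.+ inQ 1ℙ 0# ℕ.* inQ 1ℙ (0# - a)
          ≡⟨ cong₂ (λ s t → s ℕ.* inQ 0ℙ (0# - a) ℕ.+ t ℕ.* inQ 1ℙ (0# - a)) (inQ-zero 0ℙ) (inQ-zero 1ℙ) ⟩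
        0
          ≡⟨ sym (cong (ℕ._* inQ 0ℙ 1#) (⟦⟧-no (¬? (1# FP.≟ 1#)) (λ 1≢1 → 1≢1 refl))) ⟩
        inQ₀-except-1 1#
          ≡⟨ cong inQ₀-except-1 (sym g-0) ⟩
        inQ₀-except-1 (g 0#) ∎
      by-cases _ (no _) (yes refl) = begin
        inQ 0ℙ a ℕ.* inQ 0ℙ (a - a) ℕ.+ inQ 1ℙ a ℕ.* inQ 1ℙ (a - a)
          ≡⟨ cong₂ (λ s t → inQ 0ℙ a ℕ.* s ℕ.+ inQ 1ℙ a ℕ.* t) (inQ-a-a 0ℙ) (inQ-a-a 1ℙ) ⟩
        inQ 0ℙ a ℕ.* 0 ℕ.+ inQ 1ℙ a ℕ.* 0
          ≡⟨ cong₂ ℕ._+_ (NP.*-zeroʳ (inQ 0ℙ a)) (NP.*-zeroʳ (inQ 1ℙ a)) ⟩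
        0
          ≡⟨ sym (NP.*-zeroʳ ⟦ ¬? (0# FP.≟ 1#) ⟧) ⟩
        ⟦ ¬? (0# FP.≟ 1#) ⟧ ℕ.* 0
          ≡⟨ cong (⟦ ¬? (0# FP.≟ 1#) ⟧ ℕ.*_) (sym (inQ-zero 0ℙ)) ⟩
        inQ₀-except-1 0#
          ≡⟨ cong inQ₀-except-1 (sym g-a) ⟩
        inQ₀-except-1 (g a) ∎
        where
        inQ-a-a : ∀ e → inQ e (a - a) ≡ 0
        inQ-a-a e = trans (cong (inQ e) (-‿inverseʳ a)) (inQ-zero e)
      by-cases x (no x≢0) (no x≢a) = begin
        inQ 0ℙ x ℕ.* inQ 0ℙ (x - a) ℕ.+ inQ 1ℙ x ℕ.* inQ 1ℙ (x - a)
          ≡⟨ cong₂ ℕ._+_ (cong₂ ℕ._*_ (inQ-nonzero x≢0 0ℙ) (inQ-nonzero (x-a≢0 x≢0 x≢a) 0ℙ))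
                         (cong₂ ℕ._*_ (inQ-nonzero x≢0 1ℙ) (inQ-nonzero (x-a≢0 x≢0 x≢a) 1ℙ)) ⟩
        ⟦ χ x ≟ 0ℙ ⟧ ℕ.* ⟦ χ (x - a) ≟ 0ℙ ⟧ ℕ.+ ⟦ χ x ≟ 1ℙ ⟧ ℕ.* ⟦ χ (x - a) ≟ 1ℙ ⟧
          ≡⟨ agree (χ x) (χ (x - a)) ⟩
        1 ℕ.* ⟦ χ (x - a) ℙ.+ χ x ≟ 0ℙ ⟧
          ≡⟨ cong₂ ℕ._*_ (sym (⟦⟧-yes (¬? (g x FP.≟ 1#)) (g≢1 x≢0 x≢a)))
                         (sym (trans (inQ-nonzero (g≢0 x≢0 x≢a) 0ℙ) (cong (λ p → ⟦ p ≟ 0ℙ ⟧) (χ-g x≢0 x≢a)))) ⟩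
        inQ₀-except-1 (g x) ∎

  cyclotomic-diag : ∀ {a} → a ≢ 0# → cyclotomic a 0ℙ 0ℙ ℕ.+ cyclotomic a 1ℙ 1ℙ ℕ.+ 1 ≡ h
  cyclotomic-diag {a} a≢0 = begin
    cyclotomic a 0ℙ 0ℙ ℕ.+ cyclotomic a 1ℙ 1ℙ ℕ.+ 1
      ≡⟨ cong₂ ℕ._+_ (sym (∑-distrib-+ (λ x → inQ 0ℙ x ℕ.* inQ 0ℙ (x - a)) (λ x → inQ 1ℙ x ℕ.* inQ 1ℙ (x - a))))
                     1≡inQ₀1 ⟩
    ∑[ x < q ] (inQ 0ℙ x ℕ.* inQ 0ℙ (x - a) ℕ.+ inQ 1ℙ x ℕ.* inQ 1ℙ (x - a)) ℕ.+ inQ 0ℙ 1#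
      ≡⟨ cong (ℕ._+ inQ 0ℙ 1#) (sum-cong-≗ same-character) ⟩
    ∑[ x < q ] inQ₀-except-1 (1# + - a * x ⁻¹) ℕ.+ inQ 0ℙ 1#
      ≡⟨ cong (ℕ._+ inQ 0ℙ 1#) (trans (∑-⁻¹ (λ u → inQ₀-except-1 (1# + - a * u)))
                                      (∑-affine (-‿nonzero a≢0) 1# inQ₀-except-1)) ⟩
    ∑[ v < q ] inQ₀-except-1 v ℕ.+ inQ 0ℙ 1#
      ≡⟨ NP.+-comm _ (inQ 0ℙ 1#) ⟩
    inQ 0ℙ 1# ℕ.+ ∑[ v < q ] inQ₀-except-1 v
      ≡⟨ sym (∑-split-at 1# (inQ 0ℙ)) ⟩
    ∑[ v < q ] inQ 0ℙ v
      ≡⟨ ∑-inQ 0ℙ ⟩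
    h ∎
    where
    open DiagonalSubstitution a≢0
    1≡inQ₀1 : 1 ≡ inQ 0ℙ 1#
    1≡inQ₀1 = sym (trans (inQ-nonzero 1≢0 0ℙ) (cong (λ p → ⟦ p ≟ 0ℙ ⟧) χ-1))

  cyclotomic-system : ∀ {a} → a ≢ 0# → CyclotomicSystem h (χ (- 1#)) (χ a) (cyclotomic a)
  cyclotomic-system a≢0 = record
    { row = cyclotomic-row a≢0 ; col = cyclotomic-col a≢0 ; diag = cyclotomic-diag a≢0 }

  ∑-cyclotomic : ∀ a (Φ : Parity → Parity → ℕ) →
                 ∑[ x < q ] (ε x ℕ.* ε (x - a) ℕ.* Φ (χ x) (χ (x - a))) ≡ ⟨ cyclotomic a , Φ ⟩
  ∑-cyclotomic a Φ = begin
    ∑[ x < q ] (w x ℕ.* Φ (χ x) (χ (x - a)))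
      ≡⟨ ∑-fibres χ (λ x e → w x ℕ.* Φ e (χ (x - a))) ⟩
    ∑ₚ (λ e → ∑[ x < q ] (⟦ χ x ≟ e ⟧ ℕ.* (w x ℕ.* Φ e (χ (x - a)))))
      ≡⟨ ∑ₚ-cong (λ e → ∑-fibres (λ x → χ (x - a)) (λ x d → ⟦ χ x ≟ e ⟧ ℕ.* (w x ℕ.* Φ e d))) ⟩
    ∑ₚ (λ e → ∑ₚ (λ d → ∑[ x < q ] (⟦ χ (x - a) ≟ d ⟧ ℕ.* (⟦ χ x ≟ e ⟧ ℕ.* (w x ℕ.* Φ e d)))))
      ≡⟨ ∑ₚ-cong (λ e → ∑ₚ-cong (λ d → fibre e d)) ⟩
    ⟨ cyclotomic a , Φ ⟩ ∎
    where
    w : Fin q → ℕ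
    w x = ε x ℕ.* ε (x - a)
    regroup : ∀ r p s t φ → r ℕ.* (p ℕ.* (s ℕ.* t ℕ.* φ)) ≡ s ℕ.* p ℕ.* (t ℕ.* r) ℕ.* φ
    regroup = solve-∀
    fibre : ∀ e d → ∑[ x < q ] (⟦ χ (x - a) ≟ d ⟧ ℕ.* (⟦ χ x ≟ e ⟧ ℕ.* (w x ℕ.* Φ e d)))
                    ≡ cyclotomic a e d ℕ.* Φ e d
    fibre e d = trans (sum-cong-≗ (λ x → regroup ⟦ χ (x - a) ≟ d ⟧ ⟦ χ x ≟ e ⟧ (ε x) (ε (x - a)) (Φ e d)))
                      (sym (*-distribʳ-sum (Φ e d) (λ x → inQ e x ℕ.* inQ d (x - a))))

  inQ*inQ : ∀ e d x → inQ e x ℕ.* inQ d x ≡ ⟦ e ≟ d ⟧ ℕ.* inQ e x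
  inQ*inQ e d x = by-cases x (x FP.≟ 0#)
    where
    by-cases : ∀ x → Dec (x ≡ 0#) → inQ e x ℕ.* inQ d x ≡ ⟦ e ≟ d ⟧ ℕ.* inQ e x
    by-cases _ (yes refl) rewrite inQ-zero e = sym (NP.*-zeroʳ ⟦ e ≟ d ⟧)
    by-cases x (no x≢0) rewrite inQ-nonzero x≢0 e | inQ-nonzero x≢0 d = ⟦≟⟧*⟦≟⟧ (χ x) e d

  cyclotomic-0 : ∀ e d → cyclotomic 0# e d ≡ ⟦ e ≟ d ⟧ ℕ.* h
  cyclotomic-0 e d = begin
    ∑[ x < q ] (inQ e x ℕ.* inQ d (x - 0#))
      ≡⟨ sum-cong-≗ (λ x → trans (cong (λ t → inQ e x ℕ.* inQ d t) (x-0≡x x)) (inQ*inQ e d x)) ⟩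
    ∑[ x < q ] (⟦ e ≟ d ⟧ ℕ.* inQ e x)
      ≡⟨ *-distribˡ-sum ⟦ e ≟ d ⟧ (inQ e) ⟨
    ⟦ e ≟ d ⟧ ℕ.* ∑[ x < q ] inQ e x
      ≡⟨ cong (⟦ e ≟ d ⟧ ℕ.*_) (∑-inQ e) ⟩
    ⟦ e ≟ d ⟧ ℕ.* h ∎

  -- the admissible second coordinates y of a connection-set element (x , y) with χ₁ x = e
  inT : Parity → Fin q → ℕ
  inT e y = δ y ℕ.+ inQ e y

  inT-0 : ∀ e → inT e 0# ≡ 1
  inT-0 e = cong₂ ℕ._+_ δ-zero (inQ-zero e)

  inT-nonzero : ∀ {y} → y ≢ 0# → ∀ e → inT e y ≡ ⟦ χ y ≟ e ⟧
  inT-nonzero y≢0 e = cong₂ ℕ._+_ (δ-nonzero y≢0) (inQ-nonzero y≢0 e)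

  pairsInT : Fin q → Parity → Parity → ℕ
  pairsInT b e d = ∑[ y < q ] (inT e y ℕ.* inT d (y - b))

  pairsInT-expand : ∀ b e d → pairsInT b e d ≡ δ (0# - b) ℕ.+ inQ d (0# - b) ℕ.+ inQ e b ℕ.+ cyclotomic b e d
  pairsInT-expand b e d = begin
    ∑[ y < q ] ((δ y ℕ.+ inQ e y) ℕ.* (δ (y - b) ℕ.+ inQ d (y - b)))
      ≡⟨ sum-cong-≗ (λ y → expand (δ y) (inQ e y) (δ (y - b)) (inQ d (y - b))) ⟩
    ∑[ y < q ] (A y ℕ.+ B y ℕ.+ C y ℕ.+ D y)
      ≡⟨ ∑-distrib-+ (λ y → A y ℕ.+ B y ℕ.+ C y) D ⟩
    ∑[ y < q ] (A y ℕ.+ B y ℕ.+ C y) ℕ.+ ∑[ y < q ] D y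
      ≡⟨ cong (ℕ._+ ∑[ y < q ] D y) (trans (∑-distrib-+ (λ y → A y ℕ.+ B y) C)
                                          (cong (ℕ._+ ∑[ y < q ] C y) (∑-distrib-+ A B))) ⟩
    ∑[ y < q ] A y ℕ.+ ∑[ y < q ] B y ℕ.+ ∑[ y < q ] C y ℕ.+ ∑[ y < q ] D y
      ≡⟨ cong (ℕ._+ cyclotomic b e d)
              (cong₂ ℕ._+_ (cong₂ ℕ._+_ (∑-select 0# (λ y → δ (y - b))) (∑-select 0# (λ y → inQ d (y - b)))) ∑C) ⟩
    δ (0# - b) ℕ.+ inQ d (0# - b) ℕ.+ inQ e b ℕ.+ cyclotomic b e d ∎
    where
    A B C D : Fin q → ℕ
    A y = δ y ℕ.* δ (y - b)
    B y = δ y ℕ.* inQ d (y - b)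
    C y = inQ e y ℕ.* δ (y - b)
    D y = inQ e y ℕ.* inQ d (y - b)
    expand : ∀ s t u v → (s ℕ.+ t) ℕ.* (u ℕ.+ v) ≡ s ℕ.* u ℕ.+ s ℕ.* v ℕ.+ t ℕ.* u ℕ.+ t ℕ.* v
    expand = solve-∀
    ∑C : ∑[ y < q ] C y ≡ inQ e b
    ∑C = trans (sum-cong-≗ (λ y → trans (cong (inQ e y ℕ.*_) (δ-sub y b)) (NP.*-comm (inQ e y) ⟦ y FP.≟ b ⟧)))
               (∑-select b (inQ e))

  pairsInT-0 : ∀ e d → pairsInT 0# e d ≡ weightC₁ h e d
  pairsInT-0 e d = begin
    pairsInT 0# e d
      ≡⟨ pairsInT-expand 0# e d ⟩
    δ (0# - 0#) ℕ.+ inQ d (0# - 0#) ℕ.+ inQ e 0# ℕ.+ cyclotomic 0# e d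
      ≡⟨ cong (λ t → δ t ℕ.+ inQ d t ℕ.+ inQ e 0# ℕ.+ cyclotomic 0# e d) (-‿inverseʳ 0#) ⟩
    δ 0# ℕ.+ inQ d 0# ℕ.+ inQ e 0# ℕ.+ cyclotomic 0# e d
      ≡⟨ cong₂ ℕ._+_ (cong₂ ℕ._+_ (cong₂ ℕ._+_ δ-zero (inQ-zero d)) (inQ-zero e)) (cyclotomic-0 e d) ⟩
    1 ℕ.+ ⟦ e ≟ d ⟧ ℕ.* h ∎

  pairsInT-nonzero : ∀ {b} → b ≢ 0# → ∀ e d → pairsInT b e d ≡ weightD₀ (χ (- 1#)) (χ b) (cyclotomic b) e d
  pairsInT-nonzero {b} b≢0 e d = begin
    pairsInT b e d
      ≡⟨ pairsInT-expand b e d ⟩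
    δ (0# - b) ℕ.+ inQ d (0# - b) ℕ.+ inQ e b ℕ.+ cyclotomic b e d
      ≡⟨ cong (λ t → δ t ℕ.+ inQ d t ℕ.+ inQ e b ℕ.+ cyclotomic b e d) (+-identityˡ (- b)) ⟩
    δ (- b) ℕ.+ inQ d (- b) ℕ.+ inQ e b ℕ.+ cyclotomic b e d
      ≡⟨ cong (ℕ._+ cyclotomic b e d) (cong₂ ℕ._+_ (cong₂ ℕ._+_ (δ-nonzero (-‿nonzero b≢0)) -b-term) (inQ-nonzero b≢0 e)) ⟩
    ⟦ χ (- 1#) ℙ.+ χ b ≟ d ⟧ ℕ.+ ⟦ χ b ≟ e ⟧ ℕ.+ cyclotomic b e d ∎
    where
    -b-term : inQ d (- b) ≡ ⟦ χ (- 1#) ℙ.+ χ b ≟ d ⟧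
    -b-term = trans (inQ-nonzero (-‿nonzero b≢0) d) (cong (λ p → ⟦ p ≟ d ⟧) (χ-neg b≢0))

module Gamma2Properties {h₁ h₂} (F₁ : FiniteField (suc (h₁ ℕ.+ h₁))) (F₂ : FiniteField (suc (h₂ ℕ.+ h₂)))
                        {α₁ α₂} (α₁-primitive : FiniteField.IsPrimitive F₁ α₁)
                        (α₂-primitive : FiniteField.IsPrimitive F₂ α₂) where
  private
    q₁ q₂ : ℕ
    q₁ = suc (h₁ ℕ.+ h₁)
    q₂ = suc (h₂ ℕ.+ h₂)
    module 𝔽₁ = FiniteField F₁
    module 𝔽₂ = FiniteField F₂
    module P₁ = FieldProperties F₁
    module P₂ = FieldProperties F₂
    module E₁ = PrimitiveElement F₁ α₁ α₁-primitive
    module Q₁ = QuadraticCharacter {h₁} F₁ α₁ α₁-primitive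
    module Q₂ = QuadraticCharacter {h₂} F₂ α₂ α₂-primitive
  open Gamma2 F₁ F₂ α₁ α₂
  open Counting
  open CyclotomicArithmetic
  open ≡-Reasoning

  π₁ π₂ : Parity
  π₁ = Q₁.χ (𝔽₁.- 𝔽₁.1#)
  π₂ = Q₂.χ (𝔽₂.- 𝔽₂.1#)

  InS⇔ : ∀ x y → InS (x , y) ⇔ (x ≢ 𝔽₁.0# × (y ≢ 𝔽₂.0# → Q₁.χ x ≡ Q₂.χ y))
  InS⇔ x y = mk⇔ to from
    where
    to : InS (x , y) → x ≢ 𝔽₁.0# × (y ≢ 𝔽₂.0# → Q₁.χ x ≡ Q₂.χ y)
    to (inj₁ (k , refl , refl)) = E₁.α^-nonzero (toℕ k) , λ 0≢0 → ⊥-elim (0≢0 refl)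
    to (inj₂ (i₁ , i₂ , i₁≡i₂ , refl , refl)) = E₁.α^-nonzero (toℕ i₁) , λ _ → begin
      Q₁.χ (α₁ 𝔽₁.^ toℕ i₁)   ≡⟨ Q₁.χ-α^ (toℕ i₁) ⟩
      parity (toℕ i₁)         ≡⟨ Equivalence.from (parity≡⇔%2≡ {toℕ i₁} {toℕ i₂}) i₁≡i₂ ⟩
      parity (toℕ i₂)         ≡⟨ Q₂.χ-α^ (toℕ i₂) ⟨
      Q₂.χ (α₂ 𝔽₂.^ toℕ i₂)   ∎
    from : x ≢ 𝔽₁.0# × (y ≢ 𝔽₂.0# → Q₁.χ x ≡ Q₂.χ y) → InS (x , y)
    from (x≢0 , same-χ) with Q₁.discrete-log x≢0 | y FP.≟ 𝔽₂.0#
    ... | i₁ , x≡αⁱ | yes y≡0 = inj₁ (i₁ , x≡αⁱ , y≡0)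
    ... | i₁ , x≡αⁱ | no y≢0 with Q₂.discrete-log y≢0
    ...   | i₂ , y≡αʲ = inj₂ (i₁ , i₂ , Equivalence.to (parity≡⇔%2≡ {toℕ i₁} {toℕ i₂}) parities , x≡αⁱ , y≡αʲ)
      where
      parities : parity (toℕ i₁) ≡ parity (toℕ i₂)
      parities = begin
        parity (toℕ i₁)         ≡⟨ Q₁.χ-α^ (toℕ i₁) ⟨
        Q₁.χ (α₁ 𝔽₁.^ toℕ i₁)   ≡⟨ cong Q₁.χ x≡αⁱ ⟨
        Q₁.χ x                  ≡⟨ same-χ y≢0 ⟩
        Q₂.χ y                  ≡⟨ cong Q₂.χ y≡αʲ ⟩
        Q₂.χ (α₂ 𝔽₂.^ toℕ i₂)   ≡⟨ Q₂.χ-α^ (toℕ i₂) ⟩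
        parity (toℕ i₂)         ∎

  inS : Fin q₁ → Fin q₂ → ℕ
  inS x y = Q₁.ε x ℕ.* Q₂.inT (Q₁.χ x) y

  ⟦InS?⟧ : ∀ x y → ⟦ InS? (x , y) ⟧ ≡ inS x y
  ⟦InS?⟧ x y = by-cases (x FP.≟ 𝔽₁.0#) (y FP.≟ 𝔽₂.0#)
    where
    by-cases : Dec (x ≡ 𝔽₁.0#) → Dec (y ≡ 𝔽₂.0#) → ⟦ InS? (x , y) ⟧ ≡ inS x y
    by-cases (yes x≡0) _ = begin
      ⟦ InS? (x , y) ⟧
        ≡⟨ ⟦⟧-no (InS? (x , y)) (λ s → proj₁ (Equivalence.to (InS⇔ x y) s) x≡0) ⟩
      0 ℕ.* Q₂.inT (Q₁.χ x) y
        ≡⟨ cong (ℕ._* Q₂.inT (Q₁.χ x) y) (trans (cong Q₁.ε x≡0) Q₁.ε-zero) ⟨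
      inS x y ∎
    by-cases (no x≢0) (yes y≡0) = begin
      ⟦ InS? (x , y) ⟧
        ≡⟨ ⟦⟧-yes (InS? (x , y)) (Equivalence.from (InS⇔ x y) (x≢0 , λ y≢0 → ⊥-elim (y≢0 y≡0))) ⟩
      1 ℕ.* 1
        ≡⟨ cong₂ ℕ._*_ (Q₁.ε-nonzero x≢0) (trans (cong (Q₂.inT (Q₁.χ x)) y≡0) (Q₂.inT-0 (Q₁.χ x))) ⟨
      inS x y ∎
    by-cases (no x≢0) (no y≢0) = begin
      ⟦ InS? (x , y) ⟧            ≡⟨ ⟦⟧-⇔ InS⇔χ (InS? (x , y)) (Q₂.χ y ℙP.≟ Q₁.χ x) ⟩
      ⟦ Q₂.χ y ℙP.≟ Q₁.χ x ⟧      ≡⟨ NP.*-identityˡ _ ⟨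
      1 ℕ.* ⟦ Q₂.χ y ℙP.≟ Q₁.χ x ⟧ ≡⟨ cong₂ ℕ._*_ (Q₁.ε-nonzero x≢0) (Q₂.inT-nonzero y≢0 (Q₁.χ x)) ⟨
      inS x y                     ∎
      where
      InS⇔χ : InS (x , y) ⇔ (Q₂.χ y ≡ Q₁.χ x)
      InS⇔χ = mk⇔ (λ s → sym (proj₂ (Equivalence.to (InS⇔ x y) s) y≢0))
                  (λ eq → Equivalence.from (InS⇔ x y) (x≢0 , λ _ → sym eq))

  fst : V → Fin q₁
  fst u = proj₁ (pair u)

  snd : V → Fin q₂
  snd u = proj₂ (pair u)

  vertex : Fin q₁ → Fin q₂ → V
  vertex = combine

  pair-vertex : ∀ x y → pair (vertex x y) ≡ (x , y)
  pair-vertex = FP.remQuot-combine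

  pair-injective : ∀ {u v} → fst u ≡ fst v → snd u ≡ snd v → u ≡ v
  pair-injective {u} {v} fst≡ snd≡ =
    trans (sym (FP.combine-remQuot {q₁} q₂ u)) (trans (cong₂ combine fst≡ snd≡) (FP.combine-remQuot {q₁} q₂ v))

  [adjᵇ] : ∀ u v → [ adjᵇ u v ] ≡ inS (fst v 𝔽₁.- fst u) (snd v 𝔽₂.- snd u)
  [adjᵇ] u v = trans (cong [_] (isYes≗does (Arc? u v))) (⟦InS?⟧ _ _)

  [adjᵇ]-vertex : ∀ u x y → [ adjᵇ u (vertex x y) ] ≡ inS (x 𝔽₁.- fst u) (y 𝔽₂.- snd u)
  [adjᵇ]-vertex u x y = trans ([adjᵇ] u (vertex x y))
    (cong (λ p → inS (proj₁ p 𝔽₁.- fst u) (proj₂ p 𝔽₂.- snd u)) (pair-vertex x y))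

  count≡∑∑ : ∀ P → count P ≡ ∑[ x < q₁ ] ∑[ y < q₂ ] [ P (vertex x y) ]
  count≡∑∑ P = trans (count≡∑ P id) (∑-combine q₁ q₂ (λ w → [ P w ]))

  degree≡∑∑inS : ∀ u → degree u ≡ ∑[ x < q₁ ] ∑[ y < q₂ ] inS x y
  degree≡∑∑inS u = begin
    degree u
      ≡⟨ count≡∑∑ (adjᵇ u) ⟩
    ∑[ x < q₁ ] ∑[ y < q₂ ] [ adjᵇ u (vertex x y) ]
      ≡⟨ sum-cong-≗ (λ x → sum-cong-≗ ([adjᵇ]-vertex u x)) ⟩
    ∑[ x < q₁ ] ∑[ y < q₂ ] inS (x 𝔽₁.- fst u) (y 𝔽₂.- snd u)
      ≡⟨ sum-cong-≗ (λ x → P₂.∑-translate (𝔽₂.- snd u) (inS (x 𝔽₁.- fst u))) ⟩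
    ∑[ x < q₁ ] ∑[ y < q₂ ] inS (x 𝔽₁.- fst u) y
      ≡⟨ P₁.∑-translate (𝔽₁.- fst u) (λ x → ∑[ y < q₂ ] inS x y) ⟩
    ∑[ x < q₁ ] ∑[ y < q₂ ] inS x y ∎

  commonNeighbours₀ : Fin q₁ → Fin q₂ → ℕ
  commonNeighbours₀ a b = ∑[ x < q₁ ] ∑[ y < q₂ ] (inS x y ℕ.* inS (x 𝔽₁.- a) (y 𝔽₂.- b))

  commonNeighbours-translate : ∀ u v → commonNeighbours u v ≡ commonNeighbours₀ (fst v 𝔽₁.- fst u) (snd v 𝔽₂.- snd u)
  commonNeighbours-translate u v = begin
    commonNeighbours u v
      ≡⟨ count≡∑∑ (λ w → adjᵇ u w ∧ adjᵇ v w) ⟩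
    ∑[ i < q₁ ] ∑[ j < q₂ ] [ adjᵇ u (vertex i j) ∧ adjᵇ v (vertex i j) ]
      ≡⟨ sum-cong-≗ (λ i → sum-cong-≗ (λ j → trans ([∧] (adjᵇ u (vertex i j)) _)
                                                   (cong₂ ℕ._*_ ([adjᵇ]-vertex u i j) ([adjᵇ]-vertex v i j)))) ⟩
    ∑[ i < q₁ ] ∑[ j < q₂ ] G i j
      ≡⟨ P₁.∑-translate (fst u) (λ i → ∑[ j < q₂ ] G i j) ⟨
    ∑[ x < q₁ ] ∑[ j < q₂ ] G (x 𝔽₁.+ fst u) j
      ≡⟨ sum-cong-≗ (λ x → P₂.∑-translate (snd u) (G (x 𝔽₁.+ fst u))) ⟨
    ∑[ x < q₁ ] ∑[ y < q₂ ] G (x 𝔽₁.+ fst u) (y 𝔽₂.+ snd u)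
      ≡⟨ sum-cong-≗ (λ x → sum-cong-≗ (λ y → cong₂ ℕ._*_
           (cong₂ inS (P₁.x+y-y≡x x (fst u)) (P₂.x+y-y≡x y (snd u)))
           (cong₂ inS (P₁.[x+u]-v≡x-[v-u] x (fst u) (fst v)) (P₂.[x+u]-v≡x-[v-u] y (snd u) (snd v))))) ⟩
    commonNeighbours₀ (fst v 𝔽₁.- fst u) (snd v 𝔽₂.- snd u) ∎
    where
    G : Fin q₁ → Fin q₂ → ℕ
    G i j = inS (i 𝔽₁.- fst u) (j 𝔽₂.- snd u) ℕ.* inS (i 𝔽₁.- fst v) (j 𝔽₂.- snd v)

  commonNeighbours-vertex : ∀ x y x′ y′ →
                            commonNeighbours (vertex x y) (vertex x′ y′) ≡ commonNeighbours₀ (x′ 𝔽₁.- x) (y′ 𝔽₂.- y)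
  commonNeighbours-vertex x y x′ y′ = trans (commonNeighbours-translate (vertex x y) (vertex x′ y′))
    (cong₂ (λ p p′ → commonNeighbours₀ (proj₁ p′ 𝔽₁.- proj₁ p) (proj₂ p′ 𝔽₂.- proj₂ p))
           (pair-vertex x y) (pair-vertex x′ y′))

  commonNeighbours₀-pairing : ∀ a b → commonNeighbours₀ a b ≡ ⟨ Q₁.cyclotomic a , Q₂.pairsInT b ⟩
  commonNeighbours₀-pairing a b = trans (sum-cong-≗ factor) (Q₁.∑-cyclotomic a (Q₂.pairsInT b))
    where
    regroup : ∀ s t s′ t′ → (s ℕ.* t) ℕ.* (s′ ℕ.* t′) ≡ (s ℕ.* s′) ℕ.* (t ℕ.* t′)
    regroup = solve-∀
    factor : ∀ x → ∑[ y < q₂ ] (inS x y ℕ.* inS (x 𝔽₁.- a) (y 𝔽₂.- b))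
                   ≡ Q₁.ε x ℕ.* Q₁.ε (x 𝔽₁.- a) ℕ.* Q₂.pairsInT b (Q₁.χ x) (Q₁.χ (x 𝔽₁.- a))
    factor x = trans
      (sum-cong-≗ (λ y → regroup (Q₁.ε x) (Q₂.inT (Q₁.χ x) y) (Q₁.ε (x 𝔽₁.- a)) (Q₂.inT (Q₁.χ (x 𝔽₁.- a)) (y 𝔽₂.- b))))
      (sym (*-distribˡ-sum (Q₁.ε x ℕ.* Q₁.ε (x 𝔽₁.- a))
                           (λ y → Q₂.inT (Q₁.χ x) y ℕ.* Q₂.inT (Q₁.χ (x 𝔽₁.- a)) (y 𝔽₂.- b))))

  commonNeighbours₀-C₁ : ∀ a → commonNeighbours₀ a 𝔽₂.0# ≡ ⟨ Q₁.cyclotomic a , weightC₁ h₂ ⟩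
  commonNeighbours₀-C₁ a = trans (commonNeighbours₀-pairing a 𝔽₂.0#) (⟨⟩-congʳ (Q₁.cyclotomic a) Q₂.pairsInT-0)

  commonNeighbours₀-D₀ : ∀ a {b} → b ≢ 𝔽₂.0# →
                         commonNeighbours₀ a b ≡ ⟨ Q₁.cyclotomic a , weightD₀ π₂ (Q₂.χ b) (Q₂.cyclotomic b) ⟩
  commonNeighbours₀-D₀ a b≢0 = trans (commonNeighbours₀-pairing a _) (⟨⟩-congʳ (Q₁.cyclotomic a) (Q₂.pairsInT-nonzero b≢0))

  C₁-value : ∀ {a} → a ≢ 𝔽₁.0# → commonNeighbours₀ a 𝔽₂.0# ℕ.+ h₂ ℕ.+ 1 ≡ h₁ ℕ.+ h₁ ℕ.+ h₁ ℕ.* h₂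
  C₁-value {a} a≢0 = trans (cong (λ t → t ℕ.+ h₂ ℕ.+ 1) (commonNeighbours₀-C₁ a)) (⟨⟩-C₁ h₂ (Q₁.cyclotomic-system a≢0))

  C₁-constant : ∀ {a} → a ≢ 𝔽₁.0# → commonNeighbours₀ a 𝔽₂.0# ≡ commonNeighbours₀ 𝔽₁.1# 𝔽₂.0#
  C₁-constant {a} a≢0 = NP.+-cancelʳ-≡ h₂ (commonNeighbours₀ a 𝔽₂.0#) (commonNeighbours₀ 𝔽₁.1# 𝔽₂.0#)
    (NP.+-cancelʳ-≡ 1 (commonNeighbours₀ a 𝔽₂.0# ℕ.+ h₂) (commonNeighbours₀ 𝔽₁.1# 𝔽₂.0# ℕ.+ h₂)
      (trans (C₁-value a≢0) (sym (C₁-value P₁.1≢0))))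

  D₀-versus-C₁ : ∀ {a b} → a ≢ 𝔽₁.0# → b ≢ 𝔽₂.0# → Q₁.χ a ≡ Q₂.χ b → π₁ ≡ π₂ →
                 2 ℕ.* commonNeighbours₀ a b ℕ.+ h₁ ≡ 2 ℕ.* commonNeighbours₀ a 𝔽₂.0# ℕ.+ h₂
  D₀-versus-C₁ {a} {b} a≢0 b≢0 χa≡χb π₁≡π₂ = begin
    2 ℕ.* commonNeighbours₀ a b ℕ.+ h₁
      ≡⟨ cong (λ t → 2 ℕ.* t ℕ.+ h₁) (commonNeighbours₀-D₀ a b≢0) ⟩
    2 ℕ.* ⟨ Q₁.cyclotomic a , weightD₀ π₂ (Q₂.χ b) (Q₂.cyclotomic b) ⟩ ℕ.+ h₁
      ≡⟨ ⟨⟩-D₀ S₁ (Q₂.cyclotomic-system b≢0) ⟩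
    2 ℕ.* ⟨ Q₁.cyclotomic a , weightC₁ h₂ ⟩ ℕ.+ h₂
      ≡⟨ cong (λ t → 2 ℕ.* t ℕ.+ h₂) (commonNeighbours₀-C₁ a) ⟨
    2 ℕ.* commonNeighbours₀ a 𝔽₂.0# ℕ.+ h₂ ∎
    where
    S₁ : CyclotomicSystem h₁ π₂ (Q₂.χ b) (Q₁.cyclotomic a)
    S₁ = subst₂ (λ π η → CyclotomicSystem h₁ π η (Q₁.cyclotomic a)) π₁≡π₂ χa≡χb (Q₁.cyclotomic-system a≢0)

  Arc-vertex⇔ : ∀ x y x′ y′ → Arc (vertex x y) (vertex x′ y′) ⇔ InS (x′ 𝔽₁.- x , y′ 𝔽₂.- y)
  Arc-vertex⇔ x y x′ y′ = mk⇔ (subst InS differences) (subst InS (sym differences))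
    where
    differences : (fst (vertex x′ y′) 𝔽₁.- fst (vertex x y) , snd (vertex x′ y′) 𝔽₂.- snd (vertex x y))
                  ≡ (x′ 𝔽₁.- x , y′ 𝔽₂.- y)
    differences = cong₂ (λ p p′ → (proj₁ p′ 𝔽₁.- proj₁ p , proj₂ p′ 𝔽₂.- proj₂ p))
                        (pair-vertex x y) (pair-vertex x′ y′)

  origin : V
  origin = vertex 𝔽₁.0# 𝔽₂.0#

  Arc-origin⇔ : ∀ x y → Arc origin (vertex x y) ⇔ InS (x , y)
  Arc-origin⇔ x y = mk⇔ (λ arc → subst InS x-0,y-0≡x,y (Equivalence.to (Arc-vertex⇔ 𝔽₁.0# 𝔽₂.0# x y) arc))
                        (λ s → Equivalence.from (Arc-vertex⇔ 𝔽₁.0# 𝔽₂.0# x y) (subst InS (sym x-0,y-0≡x,y) s))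
    where
    x-0,y-0≡x,y : (x 𝔽₁.- 𝔽₁.0# , y 𝔽₂.- 𝔽₂.0#) ≡ (x , y)
    x-0,y-0≡x,y = cong₂ _,_ (P₁.x-0≡x x) (P₂.x-0≡x y)

  commonNeighbours-origin : ∀ x y → commonNeighbours origin (vertex x y) ≡ commonNeighbours₀ x y
  commonNeighbours-origin x y =
    trans (commonNeighbours-vertex 𝔽₁.0# 𝔽₂.0# x y) (cong₂ commonNeighbours₀ (P₁.x-0≡x x) (P₂.x-0≡x y))

  arc-C₁ : Arc origin (vertex 𝔽₁.1# 𝔽₂.0#)
  arc-C₁ = Equivalence.from (Arc-origin⇔ 𝔽₁.1# 𝔽₂.0#)
             (Equivalence.from (InS⇔ 𝔽₁.1# 𝔽₂.0#) (P₁.1≢0 , λ 0≢0 → ⊥-elim (0≢0 refl)))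

  arc-D₀ : Arc origin (vertex 𝔽₁.1# 𝔽₂.1#)
  arc-D₀ = Equivalence.from (Arc-origin⇔ 𝔽₁.1# 𝔽₂.1#)
             (Equivalence.from (InS⇔ 𝔽₁.1# 𝔽₂.1#) (P₁.1≢0 , λ _ → trans Q₁.χ-1 (sym Q₂.χ-1)))

  symmetric⇒π₁≡π₂ : (∀ u v → Arc u v → Arc v u) → π₁ ≡ π₂
  symmetric⇒π₁≡π₂ symmetric with Equivalence.to (InS⇔ (𝔽₁.0# 𝔽₁.- 𝔽₁.1#) (𝔽₂.0# 𝔽₂.- 𝔽₂.1#))
    (Equivalence.to (Arc-vertex⇔ 𝔽₁.1# 𝔽₂.1# 𝔽₁.0# 𝔽₂.0#) (symmetric origin (vertex 𝔽₁.1# 𝔽₂.1#) arc-D₀))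
  ... | _ , same-χ = begin
    π₁                         ≡⟨ cong Q₁.χ (P₁.+-identityˡ (𝔽₁.- 𝔽₁.1#)) ⟨
    Q₁.χ (𝔽₁.0# 𝔽₁.- 𝔽₁.1#)   ≡⟨ same-χ 0-1≢0 ⟩
    Q₂.χ (𝔽₂.0# 𝔽₂.- 𝔽₂.1#)   ≡⟨ cong Q₂.χ (P₂.+-identityˡ (𝔽₂.- 𝔽₂.1#)) ⟩
    π₂                         ∎
    where
    0-1≢0 : 𝔽₂.0# 𝔽₂.- 𝔽₂.1# ≢ 𝔽₂.0#
    0-1≢0 eq = P₂.-‿nonzero P₂.1≢0 (trans (sym (P₂.+-identityˡ (𝔽₂.- 𝔽₂.1#))) eq)

  InS-neg : π₁ ≡ π₂ → ∀ {x y} → InS (x , y) → InS (𝔽₁.- x , 𝔽₂.- y)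
  InS-neg π₁≡π₂ {x} {y} s with Equivalence.to (InS⇔ x y) s
  ... | x≢0 , same-χ = Equivalence.from (InS⇔ (𝔽₁.- x) (𝔽₂.- y)) (P₁.-‿nonzero x≢0 , same-χ′)
    where
    same-χ′ : 𝔽₂.- y ≢ 𝔽₂.0# → Q₁.χ (𝔽₁.- x) ≡ Q₂.χ (𝔽₂.- y)
    same-χ′ -y≢0 = begin
      Q₁.χ (𝔽₁.- x)        ≡⟨ Q₁.χ-neg x≢0 ⟩
      π₁ ℙ.+ Q₁.χ x        ≡⟨ cong₂ ℙ._+_ π₁≡π₂ (same-χ y≢0) ⟩
      π₂ ℙ.+ Q₂.χ y        ≡⟨ Q₂.χ-neg y≢0 ⟨
      Q₂.χ (𝔽₂.- y)        ∎
      where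
      y≢0 : y ≢ 𝔽₂.0#
      y≢0 y≡0 = -y≢0 (trans (cong 𝔽₂.-_ y≡0) P₂.-0#≈0#)

  undirected : π₁ ≡ π₂ → IsUndirected
  undirected π₁≡π₂ = symmetric , loopless
    where
    symmetric : ∀ u v → Arc u v → Arc v u
    symmetric u v uv = subst InS (cong₂ _,_ (P₁.⁻¹-anti-homo‿- (fst v) (fst u)) (P₂.⁻¹-anti-homo‿- (snd v) (snd u)))
                             (InS-neg π₁≡π₂ uv)
    loopless : ∀ u → ¬ Arc u u
    loopless u uu = proj₁ (Equivalence.to (InS⇔ _ _) uu) (P₁.-‿inverseʳ (fst u))

  nonComplete : IsNonComplete
  nonComplete = origin , vertex 𝔽₁.0# 𝔽₂.1# , distinct , non-adjacent
    where
    distinct : origin ≢ vertex 𝔽₁.0# 𝔽₂.1#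
    distinct eq =
      𝔽₂.0≢1 (cong proj₂ (trans (sym (pair-vertex 𝔽₁.0# 𝔽₂.0#)) (trans (cong pair eq) (pair-vertex 𝔽₁.0# 𝔽₂.1#))))
    non-adjacent : ¬ Arc origin (vertex 𝔽₁.0# 𝔽₂.1#)
    non-adjacent arc = proj₁ (Equivalence.to (InS⇔ 𝔽₁.0# 𝔽₂.1#) (Equivalence.to (Arc-origin⇔ 𝔽₁.0# 𝔽₂.1#) arc)) refl

  regular : IsRegular
  regular = ∑[ x < q₁ ] ∑[ y < q₂ ] inS x y , degree≡∑∑inS

  onAxis : V → Bool
  onAxis w = does (snd w FP.≟ 𝔽₂.0#)

  private
    T-does : ∀ {A : Set} (a? : Dec A) → T (does a?) → A
    T-does (yes a) _ = a

    ¬T-does : ∀ {A : Set} (a? : Dec A) → ¬ T (does a?) → ¬ A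
    ¬T-does (yes a) ¬t _ = ¬t tt
    ¬T-does (no ¬a) _    = ¬a

  clique : IsClique onAxis
  clique u v u∈ v∈ u≢v = Equivalence.from (InS⇔ _ _) (fst-differ , λ snd-differ → ⊥-elim (snd-differ snd-same))
    where
    u₂≡0 = T-does (snd u FP.≟ 𝔽₂.0#) u∈
    v₂≡0 = T-does (snd v FP.≟ 𝔽₂.0#) v∈
    snd-same : snd v 𝔽₂.- snd u ≡ 𝔽₂.0#
    snd-same = Equivalence.from P₂.x-y≡0⇔x≡y (trans v₂≡0 (sym u₂≡0))
    fst-differ : fst v 𝔽₁.- fst u ≢ 𝔽₁.0#
    fst-differ fst-same = u≢v (pair-injective (sym (Equivalence.to P₁.x-y≡0⇔x≡y fst-same)) (trans u₂≡0 (sym v₂≡0)))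

  clique-regular : ∀ v → ¬ T (onAxis v) → count (λ w → onAxis w ∧ adjᵇ v w) ≡ h₁
  clique-regular v v∉ = begin
    count (λ w → onAxis w ∧ adjᵇ v w)
      ≡⟨ count≡∑∑ (λ w → onAxis w ∧ adjᵇ v w) ⟩
    ∑[ i < q₁ ] ∑[ j < q₂ ] [ onAxis (vertex i j) ∧ adjᵇ v (vertex i j) ]
      ≡⟨ sum-cong-≗ (λ i → sum-cong-≗ (λ j → trans ([∧] (onAxis (vertex i j)) _)
                                                   (cong₂ ℕ._*_ (on-axis i j) ([adjᵇ]-vertex v i j)))) ⟩
    ∑[ i < q₁ ] ∑[ j < q₂ ] (Q₂.δ j ℕ.* inS (i 𝔽₁.- fst v) (j 𝔽₂.- snd v))
      ≡⟨ sum-cong-≗ (λ i → ∑-select 𝔽₂.0# (λ j → inS (i 𝔽₁.- fst v) (j 𝔽₂.- snd v))) ⟩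
    ∑[ i < q₁ ] inS (i 𝔽₁.- fst v) y
      ≡⟨ P₁.∑-translate (𝔽₁.- fst v) (λ x → inS x y) ⟩
    ∑[ x < q₁ ] (Q₁.ε x ℕ.* Q₂.inT (Q₁.χ x) y)
      ≡⟨ sum-cong-≗ (λ x → cong (Q₁.ε x ℕ.*_) (trans (Q₂.inT-nonzero y≢0 (Q₁.χ x)) (⟦≟⟧-sym (Q₂.χ y) (Q₁.χ x)))) ⟩
    ∑[ x < q₁ ] Q₁.inQ (Q₂.χ y) x
      ≡⟨ Q₁.∑-inQ (Q₂.χ y) ⟩
    h₁ ∎
    where
    y : Fin q₂
    y = 𝔽₂.0# 𝔽₂.- snd v
    y≢0 : y ≢ 𝔽₂.0#
    y≢0 y≡0 = ¬T-does (snd v FP.≟ 𝔽₂.0#) v∉ (sym (Equivalence.to P₂.x-y≡0⇔x≡y y≡0))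
    on-axis : ∀ i j → [ onAxis (vertex i j) ] ≡ Q₂.δ j
    on-axis i j = cong (λ p → ⟦ proj₂ p FP.≟ 𝔽₂.0# ⟧) (pair-vertex i j)

  π₁≡π₂ : h₁ ≡ h₂ → π₁ ≡ π₂
  π₁≡π₂ h₁≡h₂ = begin
    π₁          ≡⟨ system-parity (Q₁.cyclotomic-system P₁.1≢0) ⟩
    parity h₁   ≡⟨ cong parity h₁≡h₂ ⟩
    parity h₂   ≡⟨ system-parity (Q₂.cyclotomic-system P₂.1≢0) ⟨
    π₂          ∎

  edge-regular : h₁ ≡ h₂ → ∀ u v → Arc u v → commonNeighbours u v ≡ commonNeighbours₀ 𝔽₁.1# 𝔽₂.0#
  edge-regular h₁≡h₂ u v uv = trans (commonNeighbours-translate u v) (by-cases (b FP.≟ 𝔽₂.0#))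
    where
    a = fst v 𝔽₁.- fst u
    b = snd v 𝔽₂.- snd u
    a≢0 : a ≢ 𝔽₁.0#
    a≢0 = proj₁ (Equivalence.to (InS⇔ a b) uv)
    by-cases : Dec (b ≡ 𝔽₂.0#) → commonNeighbours₀ a b ≡ commonNeighbours₀ 𝔽₁.1# 𝔽₂.0#
    by-cases (yes b≡0) = trans (cong (commonNeighbours₀ a) b≡0) (C₁-constant a≢0)
    by-cases (no b≢0)  = trans D₀≡C₁ (C₁-constant a≢0)
      where
      D₀≡C₁ : commonNeighbours₀ a b ≡ commonNeighbours₀ a 𝔽₂.0#
      D₀≡C₁ = NP.*-cancelˡ-≡ (commonNeighbours₀ a b) (commonNeighbours₀ a 𝔽₂.0#) 2
        (NP.+-cancelʳ-≡ h₁ (2 ℕ.* commonNeighbours₀ a b) (2 ℕ.* commonNeighbours₀ a 𝔽₂.0#)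
        (trans (D₀-versus-C₁ a≢0 b≢0 (proj₂ (Equivalence.to (InS⇔ a b) uv) b≢0) (π₁≡π₂ h₁≡h₂))
               (cong (2 ℕ.* commonNeighbours₀ a 𝔽₂.0# ℕ.+_) (sym h₁≡h₂))))

  neumaier : h₁ ≡ h₂ → IsNeumaier
  neumaier h₁≡h₂ = undirected (π₁≡π₂ h₁≡h₂) , nonComplete ,
                   (regular , commonNeighbours₀ 𝔽₁.1# 𝔽₂.0# , edge-regular h₁≡h₂) ,
                   onAxis , h₁ , Q₁.0<h , clique , clique-regular

  neumaier⇒h₁≡h₂ : IsNeumaier → h₁ ≡ h₂
  neumaier⇒h₁≡h₂ ((symmetric , _) , _ , (_ , λ′ , edge-count) , _) = NP.+-cancelˡ-≡ (2 ℕ.* λ′) h₁ h₂ (begin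
    2 ℕ.* λ′ ℕ.+ h₁                                ≡⟨ cong (λ t → 2 ℕ.* t ℕ.+ h₁) (λ′-at arc-D₀) ⟨
    2 ℕ.* commonNeighbours₀ 𝔽₁.1# 𝔽₂.1# ℕ.+ h₁     ≡⟨ D₀-versus-C₁ P₁.1≢0 P₂.1≢0 χ1≡χ1 (symmetric⇒π₁≡π₂ symmetric) ⟩
    2 ℕ.* commonNeighbours₀ 𝔽₁.1# 𝔽₂.0# ℕ.+ h₂     ≡⟨ cong (λ t → 2 ℕ.* t ℕ.+ h₂) (λ′-at arc-C₁) ⟩
    2 ℕ.* λ′ ℕ.+ h₂                                ∎)
    where
    χ1≡χ1 : Q₁.χ 𝔽₁.1# ≡ Q₂.χ 𝔽₂.1#
    χ1≡χ1 = trans Q₁.χ-1 (sym Q₂.χ-1)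
    λ′-at : ∀ {x y} → Arc origin (vertex x y) → commonNeighbours₀ x y ≡ λ′
    λ′-at {x} {y} arc = trans (sym (commonNeighbours-origin x y)) (edge-count origin (vertex x y) arc)

odd⇒suc-double : ∀ q → Odd q → ∃[ h ] (q ≡ suc (h ℕ.+ h))
odd⇒suc-double zero          odd = ⊥-elim (odd (divides 0 refl))
odd⇒suc-double (suc zero)    _   = 0 , refl
odd⇒suc-double (suc (suc q)) odd with odd⇒suc-double q (λ 2∣q → odd (∣m∣n⇒∣m+n (n∣n {2}) 2∣q))
... | h , refl = suc h , cong (λ n → suc (suc n)) (sym (NP.+-suc h h))

double-injective : ∀ {m n} → m ℕ.+ m ≡ n ℕ.+ n → m ≡ n
double-injective {m} {n} eq = NP.*-cancelˡ-≡ m n 2 (trans (twice m) (trans eq (sym (twice n))))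
  where
  twice : ∀ k → 2 ℕ.* k ≡ k ℕ.+ k
  twice k = cong (k ℕ.+_) (NP.+-identityʳ k)

corollary4p2 : (q₁ q₂ : ℕ) → IsPrimePower q₁ → IsPrimePower q₂ → Odd q₁ → Odd q₂ →
               (F₁ : FiniteField q₁) (F₂ : FiniteField q₂) (α₁ : Fin q₁) (α₂ : Fin q₂) →
               FiniteField.IsPrimitive F₁ α₁ → FiniteField.IsPrimitive F₂ α₂ →
               Gamma2.IsNeumaier F₁ F₂ α₁ α₂ ⇔ (q₁ ≡ q₂)
corollary4p2 q₁ q₂ _ _ odd₁ odd₂ F₁ F₂ α₁ α₂ α₁-primitive α₂-primitive
  with odd⇒suc-double q₁ odd₁ | odd⇒suc-double q₂ odd₂
... | h₁ , refl | h₂ , refl =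
  mk⇔ (λ neumaier-graph → cong (λ h → suc (h ℕ.+ h)) (neumaier⇒h₁≡h₂ neumaier-graph))
      (λ q₁≡q₂ → neumaier (double-injective (NP.suc-injective q₁≡q₂)))
  where
  open Gamma2Properties {h₁} {h₂} F₁ F₂ α₁-primitive α₂-primitive
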